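{- Let $G$ be a graph. \begin{itemize} \item Let $X \subseteq V$ such that $u \in X$ and $G*X$ is defined, then $$ q_1(G) = q_1(G\setminus u) + q_1(G*X\setminus u). $$ \item If $\{u,v\}$ is an edge of $G$ where both $u$ and $v$ do not have loops, then \begin{eqnarray*} q_2(G) &=& q_2(G*\{u,v\}\setminus \{u,v\}) + q_2(G\mathbin{\bar{*}} \{v\}*\{u\}\setminus \{u,v\}) + q_2(G\mathbin{\bar{*}} \{u\}\setminus u) \\ &=& q_2(G*\{u,v\}\setminus \{u,v\}) + q_2(G*\{u,v\}\mathbin{\bar{*}} \{v\}\setminus \{u,v\}) + q_2(G\mathbin{\bar{*}} \{u\}\setminus u). \end{eqnarray*} \item Let $Y \subseteq V$ such that $u \in Y$ and $G\mathbin{\bar{*}} Y$ is defined, then $$ q_3(G) = q_3(G\setminus u) + q_3(G\mathbin{\bar{*}} Y\setminus u). $$ \end{itemize}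
   Context: Graphs are undirected without parallel edges, loops allowed, with vertex set $V$; a graph is identified with its symmetric adjacency matrix over $\mathbb{F}_2$ (diagonal entry $1$ iff the vertex has a loop), and $n(\cdot)$ denotes nullity over $\mathbb{F}_2$ (the empty matrix has nullity $0$). $G[X]$ is the induced subgraph (principal submatrix) on $X$, $G\setminus u = G[V\setminus\{u\}]$, and $G\setminus\{u,v\}=G[V\setminus\{u,v\}]$. For $X\subseteq V$ with $G[X]$ nonsingular, $G*X$ is the principal pivot transform of the adjacency matrix on $X$ (again a graph), defined only in that case. $G+X$ is loop complementation: toggle the loops at the vertices of $X$. The dual pivot is $G\mathbin{\bar{*}} X = G+X*X+X$, defined when the pivot inside is defined; operations are applied left to right. The graph polynomials are $q_1(G)=\sum_{X\subseteq V} y^{n(G[X])}$, $q_2(G)=\sum_{X\subseteq V} y^{n(G+X)}$, and $q_3(G)=\sum_{X\subseteq V} y^{n((G+V)[X])}$. -}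

module Defs where

open import Data.Bool using (Bool; true; false; not; _∧_; _xor_; if_then_else_)
open import Data.Nat using (ℕ; zero; suc; _+_; _∸_)
open import Data.Fin using (Fin; zero; suc; _≟_)
open import Data.Fin.Subset using (Subset; ⁅_⁆; _∪_; ∁; ⊤)
open import Data.List using (List; []; _∷_; map; length; foldr; zipWith; filter)
open import Data.Vec using (Vec; []; _∷_; lookup)
open import Data.Maybe using (Maybe; just; nothing)
open import Data.Product using (Σ; _×_; ∃)
open import Relation.Nullary.Decidable using (⌊_⌋)
open import Relation.Binary.PropositionalEquality using (_≡_)

-- Graphs on vertex set V = Fin n, identified with their symmetric
-- adjacency matrices over F₂ = Bool (diagonal entry true iff loop).

Mat : ℕ → Set
Mat n = Fin n → Fin n → Bool

Symmetric : ∀ {n} → Mat n → Set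
Symmetric {n} A = ∀ (i j : Fin n) → A i j ≡ A j i

_∈ᵇ_ : ∀ {n} → Fin n → Subset n → Bool
i ∈ᵇ X = lookup X i

δ : ∀ {n} → Fin n → Fin n → Bool
δ i j = ⌊ i ≟ j ⌋

firstOne : List Bool → Maybe ℕ
firstOne [] = nothing
firstOne (true ∷ _) = just zero
firstOne (false ∷ bs) with firstOne bs
... | just k = just (suc k)
... | nothing = nothing

nth : List Bool → ℕ → Bool
nth [] _ = false
nth (b ∷ _) zero = b
nth (_ ∷ bs) (suc k) = nth bs k

elimRow : ℕ → List Bool → List Bool → List Bool
elimRow p r s = if nth s p then zipWith _xor_ s r else s

rankFuel : ℕ → List (List Bool) → ℕ
rankFuel zero _ = zero
rankFuel (suc f) [] = zero
rankFuel (suc f) (r ∷ rs) with firstOne r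
... | nothing = rankFuel f rs
... | just p  = suc (rankFuel f (map (elimRow p r) rs))

rank : List (List Bool) → ℕ
rank rs = rankFuel (length rs) rs

elems : ∀ {n} → Subset n → List (Fin n)
elems [] = []
elems (true ∷ X) = zero ∷ map suc (elems X)
elems (false ∷ X) = map suc (elems X)

-- nullity over F₂ of the principal submatrix A[X]
-- (the empty matrix has nullity 0)
nullityOn : ∀ {n} → Mat n → Subset n → ℕ
nullityOn A X = length ix ∸ rank (map (λ i → map (λ j → A i j) ix) ix)
  where ix = elems X

_+ᴸ_ : ∀ {n} → Mat n → Subset n → Mat n
(A +ᴸ X) i j = A i j xor (δ i j ∧ (i ∈ᵇ X))

-- Principal pivot transform over F₂ (signs are irrelevant in F₂).
-- Write A = [[P, Q], [R, S]] with P = A[X].  Then A * X is defined iff P is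
-- nonsingular, and A * X = [[P⁻¹, P⁻¹Q], [R P⁻¹, S + R P⁻¹ Q]].

sumOver : ∀ {n} → Subset n → (Fin n → Bool) → Bool
sumOver X f = foldr (λ k b → f k xor b) false (elems X)

IsInverseOn : ∀ {n} → Mat n → Subset n → Mat n → Set
IsInverseOn {n} A X Pinv =
  (∀ (i j : Fin n) → i ∈ᵇ X ≡ true → j ∈ᵇ X ≡ true →
     sumOver X (λ k → A i k ∧ Pinv k j) ≡ δ i j) ×
  (∀ (i j : Fin n) → i ∈ᵇ X ≡ true → j ∈ᵇ X ≡ true →
     sumOver X (λ k → Pinv i k ∧ A k j) ≡ δ i j)

pptEntry : ∀ {n} → Mat n → Subset n → Mat n → Mat n
pptEntry A X Pinv i j with i ∈ᵇ X | j ∈ᵇ X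
... | true  | true  = Pinv i j
... | true  | false = sumOver X (λ k → Pinv i k ∧ A k j)
... | false | true  = sumOver X (λ k → A i k ∧ Pinv k j)
... | false | false = A i j xor
      sumOver X (λ k → sumOver X (λ l → A i k ∧ Pinv k l ∧ A l j))

IsPivot : ∀ {n} → Mat n → Subset n → Mat n → Set
IsPivot {n} A X B =
  Σ (Mat n) λ Pinv → IsInverseOn A X Pinv × (∀ i j → B i j ≡ pptEntry A X Pinv i j)

-- Dual pivot:  A ⊼* X = ((A + X) * X) + X ;  IsDualPivot A X B means it is
-- defined and equals B.
IsDualPivot : ∀ {n} → Mat n → Subset n → Mat n → Set
IsDualPivot {n} A X B =
  Σ (Mat n) λ C → IsPivot (A +ᴸ X) X C × (∀ i j → B i j ≡ (C +ᴸ X) i j)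

-- Graph polynomials, as coefficient sequences ℕ → ℕ (coefficient of y^k).
-- They are taken of the induced subgraph G[W] (vertex set W ⊆ V), so that
-- G \ u is  (G , ∁ ⁅ u ⁆)  and  G \ {u,v}  is  (G , ∁ (⁅ u ⁆ ∪ ⁅ v ⁆)).

subsetsOf : ∀ {n} → Subset n → List (Subset n)
subsetsOf [] = [] ∷ []
subsetsOf (true ∷ W) = map (false ∷_) (subsetsOf W) Data.List.++ map (true ∷_) (subsetsOf W)
subsetsOf (false ∷ W) = map (false ∷_) (subsetsOf W)

count : ∀ {A : Set} → (A → Bool) → List A → ℕ
count p xs = length (filter (λ x → Data.Bool._≟_ (p x) true) xs)

ℕeq : ℕ → ℕ → Bool
ℕeq m k = ⌊ Data.Nat._≟_ m k ⌋

q₁ : ∀ {n} → Mat n → Subset n → ℕ → ℕ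
q₁ A W k = count (λ X → ℕeq (nullityOn A X) k) (subsetsOf W)

-- q₂(G[W]) = Σ_{X ⊆ W} y^{n((G[W]) + X)} = Σ_{X ⊆ W} y^{n((G + X)[W])}
q₂ : ∀ {n} → Mat n → Subset n → ℕ → ℕ
q₂ A W k = count (λ X → ℕeq (nullityOn (A +ᴸ X) W) k) (subsetsOf W)

-- q₃(G[W]) = Σ_{X ⊆ W} y^{n((G[W] + W)[X])} = Σ_{X ⊆ W} y^{n((G + W)[X])}
q₃ : ∀ {n} → Mat n → Subset n → ℕ → ℕ
q₃ A W k = count (λ X → ℕeq (nullityOn (A +ᴸ W) X) k) (subsetsOf W)

_⊕_ : (ℕ → ℕ) → (ℕ → ℕ) → ℕ → ℕ
(p ⊕ q) k = p k + q k

V∖ : ∀ {n} → Fin n → Subset n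
V∖ u = ∁ ⁅ u ⁆

V∖₂ : ∀ {n} → Fin n → Fin n → Subset n
V∖₂ u v = ∁ (⁅ u ⁆ ∪ ⁅ v ⁆)

{-# OPTIONS --safe #-}

-- Everything rests on one property of the principal pivot transform over F₂: if B = A * X, then
-- n(A[Z]) = n(B[Z Δ X]) for every Z.  A nullity is recovered from the number of vectors supported
-- in Z that A[Z] annihilates (Gaussian elimination shows there are 2^n(A[Z]) of them), and replacing
-- the X-coordinates of y by those of A y maps these vectors bijectively onto the ones for B[Z Δ X].
-- Each recurrence then follows by splitting the subsets according to whether they contain u and
-- reindexing by Z ↦ Z Δ X.  Loop complementations outside X commute with pivoting on X; this handles
-- q₃ and the dual pivots.  For q₂ one splits also on v: the subsets avoiding u and v are handled by the
-- pivot on {u, v}, those containing v but not u by the dual pivot on v followed by the pivot on u, and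
-- those containing u by the dual pivot on u; finally G * {u,v} ⊼* {v} and G ⊼* {v} * {u} agree
-- outside u and v.

module Submission where

open import Defs
open import Data.Bool using (Bool; true; false; not; _∧_; _∨_; _xor_; if_then_else_)
open import Data.Bool.Properties
  using ( _≟_; not-involutive; not-distribˡ-xor; not-distribʳ-xor; ∧-assoc; ∧-comm; ∧-identityʳ; ∧-zeroʳ
        ; ∨-identityʳ; ∨-zeroʳ; ∧-distribʳ-xor; xor-identityʳ; xor-comm)
open import Data.Bool.Solver using (module xor-∧-Solver)
open import Data.Nat using (ℕ; zero; suc; pred; _+_; _*_; _^_; _∸_; _≤_; z≤n; s≤s)
open import Data.Nat.Logarithm using (⌊log₂_⌋; ⌊log₂[2^n]⌋≡n)
open import Data.Nat.Properties
  using ( +-commutativeSemigroup; +-identityʳ; *-identityʳ; *-comm; *-assoc; m≤n⇒m≤1+n; m∸n+n≡m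
        ; ^-distribˡ-+-*; *-cancelʳ-≡; m^n≢0)
open import Algebra.Properties.CommutativeSemigroup +-commutativeSemigroup
  using () renaming (interchange to +-interchange)
open import Data.Fin using (Fin; zero; suc) renaming (_≟_ to _≟ᶠ_)
open import Data.Fin.Subset using (Subset; ⊤; ⁅_⁆; _∪_; ∁)
open import Data.Vec using (Vec; []; _∷_; lookup; zipWith; toList; tabulate)
open import Data.Vec.Properties
  using (lookup-replicate; lookup-map; lookup-zipWith; ≡-dec; lookup∘tabulate; tabulate∘lookup; tabulate-cong)
open import Data.List as List using (List; []; _∷_; foldr; map; length)
import Data.List.Properties as List
open import Data.Product using (Σ; _×_; _,_; proj₁; proj₂)
open import Data.Sum using (_⊎_; inj₁; inj₂)
open import Data.Maybe using (just; nothing)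
open import Data.List.Relation.Unary.All as All using (All; []; _∷_)
import Data.List.Relation.Unary.All.Properties as All
open import Function using (_∘_)
open import Relation.Binary.PropositionalEquality
open import Relation.Nullary using (Dec; does; yes; no)
open import Relation.Nullary.Decidable using (isYes≗does; dec-true; dec-false)

open xor-∧-Solver using (solve; _:+_; _:*_; _:=_)
open ≡-Reasoning

variable
  n : ℕ

∧-cong-when : ∀ b {x y} → (b ≡ true → x ≡ y) → b ∧ x ≡ b ∧ y
∧-cong-when false _ = refl
∧-cong-when true  e = e refl

not∧-cong-when : ∀ b {x y} → (b ≡ false → x ≡ y) → not b ∧ x ≡ not b ∧ y
not∧-cong-when false e = e refl
not∧-cong-when true  _ = refl

δ-refl : (i : Fin n) → δ i i ≡ true
δ-refl i = trans (isYes≗does (i ≟ᶠ i)) (dec-true (i ≟ᶠ i) refl)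

δ-≢ : {i j : Fin n} → i ≢ j → δ i j ≡ false
δ-≢ {i = i} {j} i≢j = trans (isYes≗does (i ≟ᶠ j)) (dec-false (i ≟ᶠ j) i≢j)

δ-suc : (i k : Fin n) → δ (suc i) (suc k) ≡ δ i k
δ-suc i k = trans (isYes≗does (suc i ≟ᶠ suc k)) (sym (isYes≗does (i ≟ᶠ k)))

δ-true⇒≡ : {i j : Fin n} → δ i j ≡ true → i ≡ j
δ-true⇒≡ {i = i} {j} δij with i ≟ᶠ j
... | yes i≡j = i≡j
... | no _ with () ← δij

δ-sym : (i j : Fin n) → δ i j ≡ δ j i
δ-sym i j with i ≟ᶠ j
... | yes refl = sym (δ-refl i)
... | no i≢j = sym (δ-≢ (i≢j ∘ sym))

∈-⊤ : (i : Fin n) → i ∈ᵇ ⊤ ≡ true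
∈-⊤ i = lookup-replicate i true

∈-∁ : (X : Subset n) (i : Fin n) → i ∈ᵇ ∁ X ≡ not (i ∈ᵇ X)
∈-∁ X i = lookup-map i not X

∈∁⇒∉ : (X : Subset n) (i : Fin n) → i ∈ᵇ ∁ X ≡ true → i ∈ᵇ X ≡ false
∈∁⇒∉ X i i∈∁X = trans (sym (not-involutive _)) (cong not (trans (sym (∈-∁ X i)) i∈∁X))

∈-∪ : (X Y : Subset n) (i : Fin n) → i ∈ᵇ (X ∪ Y) ≡ i ∈ᵇ X ∨ i ∈ᵇ Y
∈-∪ X Y i = lookup-zipWith _∨_ i X Y

∈-⁅⁆ : (a i : Fin n) → i ∈ᵇ ⁅ a ⁆ ≡ δ a i
∈-⁅⁆ zero    zero    = refl
∈-⁅⁆ zero    (suc i) = lookup-replicate i false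
∈-⁅⁆ (suc a) zero    = refl
∈-⁅⁆ (suc a) (suc i) = trans (∈-⁅⁆ a i) (sym (δ-suc a i))

a∈⁅a⁆ : (a : Fin n) → a ∈ᵇ ⁅ a ⁆ ≡ true
a∈⁅a⁆ a = trans (∈-⁅⁆ a a) (δ-refl a)

∈⁅⁆⇒≡ : {a i : Fin n} → i ∈ᵇ ⁅ a ⁆ ≡ true → a ≡ i
∈⁅⁆⇒≡ {a = a} {i} i∈⁅a⁆ = δ-true⇒≡ (trans (sym (∈-⁅⁆ a i)) i∈⁅a⁆)

∈ᵇ-on-⁅⁆ : {a : Fin n} {X : Subset n} {b : Bool} → a ∈ᵇ X ≡ b → ∀ i → i ∈ᵇ ⁅ a ⁆ ≡ true → i ∈ᵇ X ≡ b
∈ᵇ-on-⁅⁆ {X = X} {b} a∈X i i∈⁅a⁆ = subst (λ j → j ∈ᵇ X ≡ b) (∈⁅⁆⇒≡ i∈⁅a⁆) a∈X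

∈-⁅⁆∪⁅⁆ : (u v i : Fin n) → i ∈ᵇ (⁅ u ⁆ ∪ ⁅ v ⁆) ≡ δ u i ∨ δ v i
∈-⁅⁆∪⁅⁆ u v i = trans (∈-∪ ⁅ u ⁆ ⁅ v ⁆ i) (cong₂ _∨_ (∈-⁅⁆ u i) (∈-⁅⁆ v i))

δ-∈∉ : (X : Subset n) {i k : Fin n} → i ∈ᵇ X ≡ true → k ∈ᵇ X ≡ false → δ i k ≡ false
δ-∈∉ X {i} {k} i∈X k∉X with δ i k in δik
... | false = refl
... | true  with () ← trans (sym i∈X) (trans (cong (_∈ᵇ X) (δ-true⇒≡ δik)) k∉X)

δ-∉∈ : (X : Subset n) {i k : Fin n} → i ∈ᵇ X ≡ false → k ∈ᵇ X ≡ true → δ i k ≡ false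
δ-∉∈ X {i} {k} i∉X k∈X = trans (δ-sym i k) (δ-∈∉ X k∈X i∉X)

∉⇒⊆V∖ : {u i : Fin n} (Z : Subset n) → u ∈ᵇ Z ≡ false → i ∈ᵇ Z ≡ true → i ∈ᵇ V∖ u ≡ true
∉⇒⊆V∖ {u = u} {i} Z u∉Z i∈Z =
  trans (∈-∁ ⁅ u ⁆ i) (cong not (trans (∈-⁅⁆ u i) (δ-∉∈ Z u∉Z i∈Z)))

∈V∖₂⇒≢ : {u v i : Fin n} → i ∈ᵇ V∖₂ u v ≡ true → δ u i ≡ false × δ v i ≡ false
∈V∖₂⇒≢ {u = u} {v} {i} i∈W
  with δ u i | δ v i | trans (sym (trans (∈-∁ (⁅ u ⁆ ∪ ⁅ v ⁆) i) (cong not (∈-⁅⁆∪⁅⁆ u v i)))) i∈W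
... | false | false | _ = refl , refl

_Δ_ : Subset n → Subset n → Subset n
_Δ_ = zipWith _xor_

∈-Δ : (Z X : Subset n) (i : Fin n) → i ∈ᵇ (Z Δ X) ≡ i ∈ᵇ Z xor i ∈ᵇ X
∈-Δ Z X i = lookup-zipWith _xor_ i Z X

∈-Δ-∈ : (Z : Subset n) {X : Subset n} {u : Fin n} → u ∈ᵇ X ≡ true → u ∈ᵇ (Z Δ X) ≡ not (u ∈ᵇ Z)
∈-Δ-∈ Z {X} {u} u∈X = trans (∈-Δ Z X u) (trans (cong (u ∈ᵇ Z xor_) u∈X) (xor-comm (u ∈ᵇ Z) true))

not-∈-Δ-∈ : (Z : Subset n) {X : Subset n} {u : Fin n} → u ∈ᵇ X ≡ true → not (u ∈ᵇ (Z Δ X)) ≡ u ∈ᵇ Z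
not-∈-Δ-∈ Z {X} {u} u∈X = trans (cong not (∈-Δ-∈ Z u∈X)) (not-involutive (u ∈ᵇ Z))

∈-Δ-∉ : (Z : Subset n) {X : Subset n} {u : Fin n} → u ∈ᵇ X ≡ false → u ∈ᵇ (Z Δ X) ≡ u ∈ᵇ Z
∈-Δ-∉ Z {X} {u} u∉X = trans (∈-Δ Z X u) (trans (cong (u ∈ᵇ Z xor_) u∉X) (xor-identityʳ (u ∈ᵇ Z)))

Δ-involutive : (Z X : Subset n) → (Z Δ X) Δ X ≡ Z
Δ-involutive []      []      = refl
Δ-involutive (b ∷ Z) (c ∷ X) =
  cong₂ _∷_ (solve 2 (λ b c → (b :+ c) :+ c := b) refl b c) (Δ-involutive Z X)

⊤-Δ : (X : Subset n) → ⊤ Δ X ≡ ∁ X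
⊤-Δ []      = refl
⊤-Δ (c ∷ X) = cong (not c ∷_) (⊤-Δ X)

lookup-ext : {y z : Subset n} → (∀ i → i ∈ᵇ y ≡ i ∈ᵇ z) → y ≡ z
lookup-ext {y = y} {z} e = trans (sym (tabulate∘lookup y)) (trans (tabulate-cong e) (tabulate∘lookup z))

sumOver-∷ : (b : Bool) (X : Subset n) (f : Fin (suc n) → Bool) →
            sumOver (b ∷ X) f ≡ (b ∧ f zero) xor sumOver X (f ∘ suc)
sumOver-∷ true  X f = cong (f zero xor_) (List.foldr-map _ suc false (elems X))
sumOver-∷ false X f = List.foldr-map _ suc false (elems X)

sumOver-cong : (X : Subset n) {f g : Fin n → Bool} →
               (∀ k → k ∈ᵇ X ≡ true → f k ≡ g k) → sumOver X f ≡ sumOver X g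
sumOver-cong []          e = refl
sumOver-cong (true ∷ X)  {f} {g} e rewrite sumOver-∷ true X f | sumOver-∷ true X g =
  cong₂ _xor_ (e zero refl) (sumOver-cong X (λ k → e (suc k)))
sumOver-cong (false ∷ X) {f} {g} e rewrite sumOver-∷ false X f | sumOver-∷ false X g =
  sumOver-cong X (λ k → e (suc k))

sumOver-false : (X : Subset n) → sumOver X (λ _ → false) ≡ false
sumOver-false []      = refl
sumOver-false (b ∷ X) rewrite sumOver-∷ b X (λ _ → false) | ∧-zeroʳ b = sumOver-false X

sumOver-xor : (X : Subset n) (f g : Fin n → Bool) →
              sumOver X (λ k → f k xor g k) ≡ sumOver X f xor sumOver X g
sumOver-xor []      f g = refl
sumOver-xor (b ∷ X) f g
  rewrite sumOver-∷ b X (λ k → f k xor g k) | sumOver-∷ b X f | sumOver-∷ b X g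
        | sumOver-xor X (f ∘ suc) (g ∘ suc) =
  solve 5 (λ b x y s t → b :* (x :+ y) :+ (s :+ t) := (b :* x :+ s) :+ (b :* y :+ t))
          refl b (f zero) (g zero) (sumOver X (f ∘ suc)) (sumOver X (g ∘ suc))

sumOver-∧ˡ : (X : Subset n) (c : Bool) (f : Fin n → Bool) →
             sumOver X (λ k → c ∧ f k) ≡ c ∧ sumOver X f
sumOver-∧ˡ []      c f = sym (∧-zeroʳ c)
sumOver-∧ˡ (b ∷ X) c f
  rewrite sumOver-∷ b X (λ k → c ∧ f k) | sumOver-∷ b X f | sumOver-∧ˡ X c (f ∘ suc) =
  solve 4 (λ b c x s → b :* (c :* x) :+ c :* s := c :* (b :* x :+ s)) refl b c (f zero) (sumOver X (f ∘ suc))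

sumOver-∧ʳ : (X : Subset n) (c : Bool) (f : Fin n → Bool) →
             sumOver X (λ k → f k ∧ c) ≡ sumOver X f ∧ c
sumOver-∧ʳ X c f = begin
  sumOver X (λ k → f k ∧ c) ≡⟨ sumOver-cong X (λ k _ → ∧-comm (f k) c) ⟩
  sumOver X (λ k → c ∧ f k) ≡⟨ sumOver-∧ˡ X c f ⟩
  c ∧ sumOver X f           ≡⟨ ∧-comm c _ ⟩
  sumOver X f ∧ c           ∎

sumOver-comm : ∀ {m} (X : Subset n) (Y : Subset m) (f : Fin n → Fin m → Bool) →
               sumOver X (λ j → sumOver Y (f j)) ≡ sumOver Y (λ l → sumOver X (λ j → f j l))
sumOver-comm []      Y f = sym (sumOver-false Y)
sumOver-comm (b ∷ X) Y f = begin
  sumOver (b ∷ X) (λ j → sumOver Y (f j))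
    ≡⟨ sumOver-∷ b X (λ j → sumOver Y (f j)) ⟩
  (b ∧ sumOver Y (f zero)) xor sumOver X (λ j → sumOver Y (f (suc j)))
    ≡⟨ cong₂ _xor_ (sym (sumOver-∧ˡ Y b (f zero))) (sumOver-comm X Y (f ∘ suc)) ⟩
  sumOver Y (λ l → b ∧ f zero l) xor sumOver Y (λ l → sumOver X (λ j → f (suc j) l))
    ≡⟨ sym (sumOver-xor Y (λ l → b ∧ f zero l) (λ l → sumOver X (λ j → f (suc j) l))) ⟩
  sumOver Y (λ l → (b ∧ f zero l) xor sumOver X (λ j → f (suc j) l))
    ≡⟨ sumOver-cong Y (λ l _ → sym (sumOver-∷ b X (λ j → f j l))) ⟩
  sumOver Y (λ l → sumOver (b ∷ X) (λ j → f j l))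
    ∎

sumOver-assoc : (X Y : Subset n) (f : Fin n → Bool) (g : Fin n → Fin n → Bool) (h : Fin n → Bool) →
                sumOver X (λ j → f j ∧ sumOver Y (λ l → g j l ∧ h l)) ≡
                sumOver Y (λ l → sumOver X (λ j → f j ∧ g j l) ∧ h l)
sumOver-assoc X Y f g h = begin
  sumOver X (λ j → f j ∧ sumOver Y (λ l → g j l ∧ h l))
    ≡⟨ sumOver-cong X (λ j _ → sym (sumOver-∧ˡ Y (f j) (λ l → g j l ∧ h l))) ⟩
  sumOver X (λ j → sumOver Y (λ l → f j ∧ (g j l ∧ h l)))
    ≡⟨ sumOver-comm X Y (λ j l → f j ∧ (g j l ∧ h l)) ⟩
  sumOver Y (λ l → sumOver X (λ j → f j ∧ (g j l ∧ h l)))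
    ≡⟨ sumOver-cong Y (λ l _ → sumOver-cong X (λ j _ → sym (∧-assoc (f j) (g j l) (h l)))) ⟩
  sumOver Y (λ l → sumOver X (λ j → (f j ∧ g j l) ∧ h l))
    ≡⟨ sumOver-cong Y (λ l _ → sumOver-∧ʳ X (h l) (λ j → f j ∧ g j l)) ⟩
  sumOver Y (λ l → sumOver X (λ j → f j ∧ g j l) ∧ h l)
    ∎

sumOver-δ : (X : Subset n) {i : Fin n} (f : Fin n → Bool) → i ∈ᵇ X ≡ true →
            sumOver X (λ k → δ i k ∧ f k) ≡ f i
sumOver-δ (true ∷ X) {zero} f _ rewrite sumOver-∷ true X (λ k → δ zero k ∧ f k) | sumOver-false X =
  xor-identityʳ (f zero)
sumOver-δ (b ∷ X) {suc i} f i∈X rewrite sumOver-∷ b X (λ k → δ (suc i) k ∧ f k) | ∧-zeroʳ b = begin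
  sumOver X (λ k → δ (suc i) (suc k) ∧ f (suc k))
    ≡⟨ sumOver-cong X (λ k _ → cong (_∧ f (suc k)) (δ-suc i k)) ⟩
  sumOver X (λ k → δ i k ∧ f (suc k))
    ≡⟨ sumOver-δ X (f ∘ suc) i∈X ⟩
  f (suc i)
    ∎

sumOver-δʳ : (X : Subset n) {i : Fin n} (f : Fin n → Bool) → i ∈ᵇ X ≡ true →
             sumOver X (λ k → f k ∧ δ k i) ≡ f i
sumOver-δʳ X {i} f i∈X = begin
  sumOver X (λ k → f k ∧ δ k i)
    ≡⟨ sumOver-cong X (λ k _ → trans (∧-comm (f k) (δ k i)) (cong (_∧ f k) (δ-sym k i))) ⟩
  sumOver X (λ k → δ i k ∧ f k)
    ≡⟨ sumOver-δ X f i∈X ⟩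
  f i
    ∎

sumOver-split : (X : Subset n) (f : Fin n → Bool) → sumOver ⊤ f ≡ sumOver X f xor sumOver (∁ X) f
sumOver-split []      f = refl
sumOver-split (b ∷ X) f
  rewrite sumOver-∷ true ⊤ f | sumOver-∷ b X f | sumOver-∷ (not b) (∁ X) f | sumOver-split X (f ∘ suc) =
  lemma b (f zero) (sumOver X (f ∘ suc)) (sumOver (∁ X) (f ∘ suc))
  where
  lemma : ∀ b x s t → x xor (s xor t) ≡ ((b ∧ x) xor s) xor ((not b ∧ x) xor t)
  lemma true  = solve 3 (λ x s t → x :+ (s :+ t) := (x :+ s) :+ t) refl
  lemma false = solve 3 (λ x s t → x :+ (s :+ t) := s :+ (x :+ t)) refl

sumOver-supported : (Z : Subset n) (f : Fin n → Bool) → (∀ j → j ∈ᵇ Z ≡ false → f j ≡ false) →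
                    sumOver Z f ≡ sumOver ⊤ f
sumOver-supported Z f f⊆Z = begin
  sumOver Z f                     ≡⟨ sym (xor-identityʳ _) ⟩
  sumOver Z f xor false           ≡⟨ cong (sumOver Z f xor_) (sym (trans off (sumOver-false (∁ Z)))) ⟩
  sumOver Z f xor sumOver (∁ Z) f ≡⟨ sym (sumOver-split Z f) ⟩
  sumOver ⊤ f                     ∎
  where
  off : sumOver (∁ Z) f ≡ sumOver (∁ Z) (λ _ → false)
  off = sumOver-cong (∁ Z) (λ j j∈∁Z → f⊆Z j (∈∁⇒∉ Z j j∈∁Z))

sumOver-⁅⁆ : (a : Fin n) (f : Fin n → Bool) → sumOver ⁅ a ⁆ f ≡ f a
sumOver-⁅⁆ a f = begin
  sumOver ⁅ a ⁆ f
    ≡⟨ sumOver-cong ⁅ a ⁆ (λ k k∈ → cong (_∧ f k) (sym (trans (sym (∈-⁅⁆ a k)) k∈))) ⟩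
  sumOver ⁅ a ⁆ (λ k → δ a k ∧ f k)
    ≡⟨ sumOver-δ ⁅ a ⁆ f (a∈⁅a⁆ a) ⟩
  f a
    ∎

sumOver-pair : {u v : Fin n} → δ u v ≡ false → (f : Fin n → Bool) →
               sumOver (⁅ u ⁆ ∪ ⁅ v ⁆) f ≡ f u xor f v
sumOver-pair {u = u} {v} uv f = begin
  sumOver X f
    ≡⟨ sumOver-cong X (λ k k∈X → split k (trans (sym (∈-⁅⁆∪⁅⁆ u v k)) k∈X)) ⟩
  sumOver X (λ k → (δ u k ∧ f k) xor (δ v k ∧ f k))
    ≡⟨ sumOver-xor X (λ k → δ u k ∧ f k) (λ k → δ v k ∧ f k) ⟩
  sumOver X (λ k → δ u k ∧ f k) xor sumOver X (λ k → δ v k ∧ f k)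
    ≡⟨ cong₂ _xor_ (sumOver-δ X f (∈X u (inj₁ refl))) (sumOver-δ X f (∈X v (inj₂ refl))) ⟩
  f u xor f v
    ∎
  where
  X = ⁅ u ⁆ ∪ ⁅ v ⁆
  ∈X : ∀ i → u ≡ i ⊎ v ≡ i → i ∈ᵇ X ≡ true
  ∈X i (inj₁ refl) = trans (∈-⁅⁆∪⁅⁆ u v u) (cong (_∨ δ v u) (δ-refl u))
  ∈X i (inj₂ refl) = trans (∈-⁅⁆∪⁅⁆ u v v) (trans (cong (δ u v ∨_) (δ-refl v)) (∨-zeroʳ (δ u v)))
  split : ∀ k → δ u k ∨ δ v k ≡ true → f k ≡ (δ u k ∧ f k) xor (δ v k ∧ f k)
  split k uk∨vk with δ u k in uk
  ... | true  rewrite sym (δ-true⇒≡ uk) | δ-sym v u | uv = sym (xor-identityʳ (f u))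
  ... | false rewrite uk∨vk = refl

⟦_⟧ : Bool → ℕ
⟦ true  ⟧ = 1
⟦ false ⟧ = 0

∑ : (Subset n → ℕ) → ℕ
∑ {zero}  h = h []
∑ {suc n} h = ∑ (λ x → h (false ∷ x)) + ∑ (λ x → h (true ∷ x))

∑-cong : {h g : Subset n → ℕ} → (∀ x → h x ≡ g x) → ∑ h ≡ ∑ g
∑-cong {zero}  e = e []
∑-cong {suc n} e = cong₂ _+_ (∑-cong (λ x → e (false ∷ x))) (∑-cong (λ x → e (true ∷ x)))

∑-+ : (h g : Subset n → ℕ) → ∑ (λ x → h x + g x) ≡ ∑ h + ∑ g
∑-+ {zero}  h g = refl
∑-+ {suc n} h g =
  trans (cong₂ _+_ (∑-+ (h ∘ (false ∷_)) (g ∘ (false ∷_))) (∑-+ (h ∘ (true ∷_)) (g ∘ (true ∷_))))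
        (+-interchange (∑ (h ∘ (false ∷_))) (∑ (g ∘ (false ∷_))) (∑ (h ∘ (true ∷_))) (∑ (g ∘ (true ∷_))))

∑-zero : ∑ {n} (λ _ → 0) ≡ 0
∑-zero {zero}  = refl
∑-zero {suc n} = cong₂ _+_ (∑-zero {n}) (∑-zero {n})

∑-comm : ∀ {m} (h : Subset n → Subset m → ℕ) →
         ∑ (λ x → ∑ (λ y → h x y)) ≡ ∑ (λ y → ∑ (λ x → h x y))
∑-comm {zero}  h = refl
∑-comm {suc n} h = trans (cong₂ _+_ (∑-comm (h ∘ (false ∷_))) (∑-comm (h ∘ (true ∷_))))
                         (sym (∑-+ (λ y → ∑ (λ x → h (false ∷ x) y)) (λ y → ∑ (λ x → h (true ∷ x) y))))

_≟ˢ_ : (x y : Subset n) → Dec (x ≡ y)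
_≟ˢ_ = ≡-dec _≟_

∑-point : (a : Subset n) (h : Subset n → ℕ) → ∑ (λ y → ⟦ does (y ≟ˢ a) ⟧ * h y) ≡ h a
∑-point         []          h = +-identityʳ (h [])
∑-point {suc n} (false ∷ a) h =
  trans (cong₂ _+_ (∑-point a (h ∘ (false ∷_))) (∑-zero {n})) (+-identityʳ (h (false ∷ a)))
∑-point {suc n} (true  ∷ a) h =
  trans (cong (_+ ∑ (λ y → ⟦ does (y ≟ˢ a) ⟧ * h (true ∷ y))) (∑-zero {n})) (∑-point a (h ∘ (true ∷_)))

∑-bijection : (f g : Subset n → Subset n) → (∀ x → g (f x) ≡ x) → (∀ y → f (g y) ≡ y) →
              (h : Subset n → ℕ) → ∑ (λ x → h (f x)) ≡ ∑ h
∑-bijection f g gf fg h = begin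
  ∑ (λ x → h (f x))
    ≡⟨ ∑-cong (λ x → sym (∑-point (f x) h)) ⟩
  ∑ (λ x → ∑ (λ y → ⟦ does (y ≟ˢ f x) ⟧ * h y))
    ≡⟨ ∑-comm (λ x y → ⟦ does (y ≟ˢ f x) ⟧ * h y) ⟩
  ∑ (λ y → ∑ (λ x → ⟦ does (y ≟ˢ f x) ⟧ * h y))
    ≡⟨ ∑-cong (λ y → ∑-cong (λ x → cong (λ b → ⟦ b ⟧ * h y) (fibre y x))) ⟩
  ∑ (λ y → ∑ (λ x → ⟦ does (x ≟ˢ g y) ⟧ * h y))
    ≡⟨ ∑-cong (λ y → ∑-point (g y) (λ _ → h y)) ⟩
  ∑ h
    ∎
  where
  fibre : ∀ y x → does (y ≟ˢ f x) ≡ does (x ≟ˢ g y)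
  fibre y x with y ≟ˢ f x
  ... | yes refl = sym (dec-true (x ≟ˢ g (f x)) (sym (gf x)))
  ... | no y≢fx  = sym (dec-false (x ≟ˢ g y) (λ x≡gy → y≢fx (trans (sym (fg y)) (cong f (sym x≡gy)))))

# : (Subset n → Bool) → ℕ
# p = ∑ (λ x → ⟦ p x ⟧)

#-cong : {p q : Subset n → Bool} → (∀ x → p x ≡ q x) → # p ≡ # q
#-cong e = ∑-cong (λ x → cong ⟦_⟧ (e x))

#-split : (c p : Subset n → Bool) → # p ≡ # (λ x → not (c x) ∧ p x) + # (λ x → c x ∧ p x)
#-split c p =
  trans (∑-cong (λ x → split (c x) (p x))) (∑-+ (λ x → ⟦ not (c x) ∧ p x ⟧) (λ x → ⟦ c x ∧ p x ⟧))
  where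
  split : ∀ c p → ⟦ p ⟧ ≡ ⟦ not c ∧ p ⟧ + ⟦ c ∧ p ⟧
  split false p = sym (+-identityʳ ⟦ p ⟧)
  split true  p = refl

#-Δ : (X : Subset n) (p : Subset n → Bool) → # (λ Z → p (Z Δ X)) ≡ # p
#-Δ X p = ∑-bijection (_Δ X) (_Δ X) (λ Z → Δ-involutive Z X) (λ Z → Δ-involutive Z X) (λ Z → ⟦ p Z ⟧)

#-reindex : (X : Subset n) {p q : Subset n → Bool} → (∀ Z → p Z ≡ q (Z Δ X)) → # p ≡ # q
#-reindex X {p} {q} p≡q = trans (#-cong p≡q) (#-Δ X q)

#-involution-halves : (σ : Subset n → Subset n) → (∀ x → σ (σ x) ≡ x) → (c p : Subset n → Bool) →
                      (∀ x → c (σ x) ≡ not (c x)) → (∀ x → p (σ x) ≡ p x) →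
                      # p ≡ 2 * # (λ x → not (c x) ∧ p x)
#-involution-halves σ σσ c p cσ pσ = begin
  # p
    ≡⟨ #-split c p ⟩
  # (λ x → not (c x) ∧ p x) + # (λ x → c x ∧ p x)
    ≡⟨ cong (# (λ x → not (c x) ∧ p x) +_) (trans swap (sym (+-identityʳ _))) ⟩
  2 * # (λ x → not (c x) ∧ p x)
    ∎
  where
  swap : # (λ x → c x ∧ p x) ≡ # (λ x → not (c x) ∧ p x)
  swap = begin
    # (λ x → c x ∧ p x)             ≡⟨ sym (∑-bijection σ σ σσ σσ (λ x → ⟦ c x ∧ p x ⟧)) ⟩
    # (λ x → c (σ x) ∧ p (σ x))     ≡⟨ #-cong (λ x → cong₂ _∧_ (cσ x) (pσ x)) ⟩
    # (λ x → not (c x) ∧ p x)       ∎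

#-true : # {n} (λ _ → true) ≡ 2 ^ n
#-true {zero}  = refl
#-true {suc n} = cong₂ _+_ (#-true {n}) (trans (#-true {n}) (sym (+-identityʳ (2 ^ n))))

allᵇ : (Fin n → Bool) → Bool
allᵇ {zero}  _ = true
allᵇ {suc n} f = f zero ∧ allᵇ (f ∘ suc)

allᵇ-cong : {f g : Fin n → Bool} → (∀ i → f i ≡ g i) → allᵇ f ≡ allᵇ g
allᵇ-cong {zero}  e = refl
allᵇ-cong {suc n} e = cong₂ _∧_ (e zero) (allᵇ-cong (e ∘ suc))

allᵇ-∧ : (f g : Fin n → Bool) → allᵇ (λ i → f i ∧ g i) ≡ allᵇ f ∧ allᵇ g
allᵇ-∧ {zero}  f g = refl
allᵇ-∧ {suc n} f g rewrite allᵇ-∧ (f ∘ suc) (g ∘ suc) =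
  solve 4 (λ a b c d → (a :* b) :* (c :* d) := (a :* c) :* (b :* d)) refl
          (f zero) (g zero) (allᵇ (f ∘ suc)) (allᵇ (g ∘ suc))

allᵇ-elim : {f : Fin n → Bool} → allᵇ f ≡ true → ∀ i → f i ≡ true
allᵇ-elim {suc n} {f} all-f zero    with f zero
allᵇ-elim {suc n} {f} all-f zero    | true = refl
allᵇ-elim {suc n} {f} all-f (suc i) with f zero
allᵇ-elim {suc n} {f} all-f (suc i) | true = allᵇ-elim all-f i

allᵇ-elems : (Z : Subset n) (f : Fin n → Bool) →
             allᵇ (λ i → not (i ∈ᵇ Z) ∨ f i) ≡ foldr (λ i b → f i ∧ b) true (elems Z)
allᵇ-elems []          f = refl
allᵇ-elems (true ∷ Z)  f =
  cong (f zero ∧_) (trans (allᵇ-elems Z (f ∘ suc)) (sym (List.foldr-map _ suc true (elems Z))))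
allᵇ-elems (false ∷ Z) f = trans (allᵇ-elems Z (f ∘ suc)) (sym (List.foldr-map _ suc true (elems Z)))

_⊆ᵇ_ : Subset n → Subset n → Bool
Y ⊆ᵇ Z = allᵇ (λ i → not (i ∈ᵇ Y) ∨ i ∈ᵇ Z)

⊆ᵇ-∉ : {Y Z : Subset n} → Y ⊆ᵇ Z ≡ true → ∀ i → i ∈ᵇ Z ≡ false → i ∈ᵇ Y ≡ false
⊆ᵇ-∉ {Y = Y} Y⊆Z i i∉Z with i ∈ᵇ Y | allᵇ-elim Y⊆Z i
... | false | _ = refl
... | true  | e = trans (sym e) i∉Z

⊆ᵇ-⊤ : (Z : Subset n) → Z ⊆ᵇ ⊤ ≡ true
⊆ᵇ-⊤ []      = refl
⊆ᵇ-⊤ (b ∷ Z) = cong₂ _∧_ (∨-zeroʳ (not b)) (⊆ᵇ-⊤ Z)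

⊆ᵇ-∁⁅⁆ : (u : Fin n) (Z : Subset n) → Z ⊆ᵇ ∁ ⁅ u ⁆ ≡ not (u ∈ᵇ Z)
⊆ᵇ-∁⁅⁆ zero    (b ∷ Z) =
  trans (cong₂ _∧_ (∨-identityʳ (not b)) (trans (cong (Z ⊆ᵇ_) ∁⊥≡⊤) (⊆ᵇ-⊤ Z))) (∧-identityʳ (not b))
  where
  ∁⊥≡⊤ : ∀ {m} → ∁ (Data.Vec.replicate m false) ≡ ⊤
  ∁⊥≡⊤ {zero}  = refl
  ∁⊥≡⊤ {suc m} = cong (true ∷_) ∁⊥≡⊤
⊆ᵇ-∁⁅⁆ (suc u) (b ∷ Z) = cong₂ _∧_ (∨-zeroʳ (not b)) (⊆ᵇ-∁⁅⁆ u Z)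

⊆ᵇ-∁∪ : (X Y Z : Subset n) → Z ⊆ᵇ ∁ (X ∪ Y) ≡ Z ⊆ᵇ ∁ X ∧ Z ⊆ᵇ ∁ Y
⊆ᵇ-∁∪ []      []      []      = refl
⊆ᵇ-∁∪ (x ∷ X) (y ∷ Y) (b ∷ Z) rewrite ⊆ᵇ-∁∪ X Y Z = lemma b x y (Z ⊆ᵇ ∁ X) (Z ⊆ᵇ ∁ Y)
  where
  lemma : ∀ b x y s t → (not b ∨ not (x ∨ y)) ∧ (s ∧ t) ≡ ((not b ∨ not x) ∧ s) ∧ ((not b ∨ not y) ∧ t)
  lemma false x     y     s t = refl
  lemma true  false false s t = refl
  lemma true  false true  s t = sym (∧-zeroʳ s)
  lemma true  true  y     s t = refl

⊆ᵇ-V∖₂ : (u v : Fin n) (Z : Subset n) → Z ⊆ᵇ V∖₂ u v ≡ not (u ∈ᵇ Z) ∧ not (v ∈ᵇ Z)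
⊆ᵇ-V∖₂ u v Z = trans (⊆ᵇ-∁∪ ⁅ u ⁆ ⁅ v ⁆ Z) (cong₂ _∧_ (⊆ᵇ-∁⁅⁆ u Z) (⊆ᵇ-∁⁅⁆ v Z))

count-∷ : {A : Set} (p : A → Bool) (x : A) (xs : List A) → count p (x ∷ xs) ≡ ⟦ p x ⟧ + count p xs
count-∷ p x xs with p x
... | true  = refl
... | false = refl

count-++ : {A : Set} (p : A → Bool) (xs ys : List A) → count p (xs List.++ ys) ≡ count p xs + count p ys
count-++ p xs ys = trans (cong length (List.filter-++ (λ x → p x ≟ true) xs ys))
                         (List.length-++ (List.filter (λ x → p x ≟ true) xs))

count-map : {A B : Set} (p : B → Bool) (f : A → B) (xs : List A) → count p (map f xs) ≡ count (p ∘ f) xs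
count-map p f []       = refl
count-map p f (x ∷ xs) = trans (count-∷ p (f x) (map f xs))
                               (trans (cong (⟦ p (f x) ⟧ +_) (count-map p f xs)) (sym (count-∷ (p ∘ f) x xs)))

count-subsetsOf : (W : Subset n) (p : Subset n → Bool) → count p (subsetsOf W) ≡ # (λ Z → Z ⊆ᵇ W ∧ p Z)
count-subsetsOf []          p = trans (count-∷ p [] []) (+-identityʳ ⟦ p [] ⟧)
count-subsetsOf (true ∷ W)  p = begin
  count p (map (false ∷_) (subsetsOf W) List.++ map (true ∷_) (subsetsOf W))
    ≡⟨ count-++ p (map (false ∷_) (subsetsOf W)) (map (true ∷_) (subsetsOf W)) ⟩
  count p (map (false ∷_) (subsetsOf W)) + count p (map (true ∷_) (subsetsOf W))
    ≡⟨ cong₂ _+_ (extend false) (extend true) ⟩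
  # (λ Z → Z ⊆ᵇ W ∧ p (false ∷ Z)) + # (λ Z → Z ⊆ᵇ W ∧ p (true ∷ Z))
    ∎
  where
  extend : ∀ b → count p (map (b ∷_) (subsetsOf W)) ≡ # (λ Z → Z ⊆ᵇ W ∧ p (b ∷ Z))
  extend b = trans (count-map p (b ∷_) (subsetsOf W)) (count-subsetsOf W (p ∘ (b ∷_)))
count-subsetsOf {suc n} (false ∷ W) p = begin
  count p (map (false ∷_) (subsetsOf W))
    ≡⟨ trans (count-map p (false ∷_) (subsetsOf W)) (count-subsetsOf W (p ∘ (false ∷_))) ⟩
  # (λ Z → Z ⊆ᵇ W ∧ p (false ∷ Z))
    ≡⟨ sym (trans (cong (# (λ Z → Z ⊆ᵇ W ∧ p (false ∷ Z)) +_) (∑-zero {n})) (+-identityʳ _)) ⟩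
  # (λ Z → Z ⊆ᵇ W ∧ p (false ∷ Z)) + ∑ {n} (λ _ → 0)
    ∎

count-subsetsOf-⊤ : (p : Subset n → Bool) → count p (subsetsOf ⊤) ≡ # p
count-subsetsOf-⊤ p = trans (count-subsetsOf ⊤ p) (#-cong (λ Z → cong (_∧ p Z) (⊆ᵇ-⊤ Z)))

count-subsetsOf-V∖ : (u : Fin n) (p : Subset n → Bool) →
                     count p (subsetsOf (V∖ u)) ≡ # (λ Z → not (u ∈ᵇ Z) ∧ p Z)
count-subsetsOf-V∖ u p = trans (count-subsetsOf (V∖ u) p) (#-cong (λ Z → cong (_∧ p Z) (⊆ᵇ-∁⁅⁆ u Z)))

count-subsetsOf-V∖₂ : (u v : Fin n) (p : Subset n → Bool) →
                      count p (subsetsOf (V∖₂ u v)) ≡ # (λ Z → (not (u ∈ᵇ Z) ∧ not (v ∈ᵇ Z)) ∧ p Z)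
count-subsetsOf-V∖₂ u v p = trans (count-subsetsOf (V∖₂ u v) p) (#-cong (λ Z → cong (_∧ p Z) (⊆ᵇ-V∖₂ u v Z)))

-- Gaussian elimination counts kernel vectors

dot : List Bool → List Bool → Bool
dot (a ∷ r) (b ∷ x) = (a ∧ b) xor dot r x
dot _       _       = false

annihilates : List (List Bool) → List Bool → Bool
annihilates []       x = true
annihilates (r ∷ rs) x = not (dot r x) ∧ annihilates rs x

flipAt : ∀ {m} → ℕ → Vec Bool m → Vec Bool m
flipAt _       []      = []
flipAt zero    (b ∷ x) = not b ∷ x
flipAt (suc p) (b ∷ x) = b ∷ flipAt p x

flipAt-involutive : ∀ {m} (p : ℕ) (x : Vec Bool m) → flipAt p (flipAt p x) ≡ x
flipAt-involutive _       []      = refl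
flipAt-involutive zero    (b ∷ x) = cong (_∷ x) (not-involutive b)
flipAt-involutive (suc p) (b ∷ x) = cong (b ∷_) (flipAt-involutive p x)

dot-flipAt-pivot : ∀ {m} (r : List Bool) (x : Vec Bool m) (p : ℕ) → length r ≡ m → nth r p ≡ true →
                   dot r (toList (flipAt p x)) ≡ not (dot r (toList x))
dot-flipAt-pivot (true ∷ r) (b ∷ x) zero    _   refl = sym (not-distribˡ-xor b (dot r (toList x)))
dot-flipAt-pivot (a ∷ r)    (b ∷ x) (suc p) len rp
  rewrite dot-flipAt-pivot r x p (cong pred len) rp = sym (not-distribʳ-xor (a ∧ b) (dot r (toList x)))

dot-flipAt-off : ∀ {m} (s : List Bool) (x : Vec Bool m) (p : ℕ) → nth s p ≡ false →
                 dot s (toList (flipAt p x)) ≡ dot s (toList x)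
dot-flipAt-off []          x       p       _  = refl
dot-flipAt-off (a ∷ s)     []      p       _  = refl
dot-flipAt-off (false ∷ s) (b ∷ x) zero    _  = refl
dot-flipAt-off (a ∷ s)     (b ∷ x) (suc p) sp = cong ((a ∧ b) xor_) (dot-flipAt-off s x p sp)

dot-zipWith-xor : (s r x : List Bool) → length s ≡ length r →
                  dot (List.zipWith _xor_ s r) x ≡ dot s x xor dot r x
dot-zipWith-xor []      []      x       _   = refl
dot-zipWith-xor (a ∷ s) (c ∷ r) []      _   = refl
dot-zipWith-xor (a ∷ s) (c ∷ r) (b ∷ x) len rewrite dot-zipWith-xor s r x (cong pred len) =
  solve 5 (λ a c b d e → (a :+ c) :* b :+ (d :+ e) := (a :* b :+ d) :+ (c :* b :+ e))
          refl a c b (dot s x) (dot r x)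

nth-zipWith-xor : (s r : List Bool) (p : ℕ) → length s ≡ length r →
                  nth (List.zipWith _xor_ s r) p ≡ nth s p xor nth r p
nth-zipWith-xor []      []      p       _   = refl
nth-zipWith-xor (a ∷ s) (c ∷ r) zero    _   = refl
nth-zipWith-xor (a ∷ s) (c ∷ r) (suc p) len = nth-zipWith-xor s r p (cong pred len)

length-zipWith-xor : (s r : List Bool) → length s ≡ length r → length (List.zipWith _xor_ s r) ≡ length s
length-zipWith-xor []      []      _   = refl
length-zipWith-xor (a ∷ s) (c ∷ r) len = cong suc (length-zipWith-xor s r (cong pred len))

firstOne-nothing : (r x : List Bool) → firstOne r ≡ nothing → dot r x ≡ false
firstOne-nothing []          x       _ = refl
firstOne-nothing (false ∷ r) []      _ = refl
firstOne-nothing (false ∷ r) (b ∷ x) e with firstOne r in e′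
firstOne-nothing (false ∷ r) (b ∷ x) () | just _
... | nothing = firstOne-nothing r x e′

firstOne-just : (r : List Bool) {p : ℕ} → firstOne r ≡ just p → nth r p ≡ true
firstOne-just (true ∷ r)  refl = refl
firstOne-just (false ∷ r) e with firstOne r in e′
firstOne-just (false ∷ r) refl | just _ = firstOne-just r e′

elimRow-length : ∀ {m} p r s → length r ≡ m → length s ≡ m → length (elimRow p r s) ≡ m
elimRow-length p r s lr ls with nth s p
... | false = ls
... | true  = trans (length-zipWith-xor s r (trans ls (sym lr))) ls

elimRow-pivot : ∀ p r s → nth r p ≡ true → length s ≡ length r → nth (elimRow p r s) p ≡ false
elimRow-pivot p r s rp len with nth s p in sp
... | false = sp
... | true  = trans (nth-zipWith-xor s r p len) (cong₂ _xor_ sp rp)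

elimRow-dot : ∀ p r s x → length s ≡ length r → dot r x ≡ false → dot (elimRow p r s) x ≡ dot s x
elimRow-dot p r s x len rx with nth s p
... | false = refl
... | true  = trans (dot-zipWith-xor s r x len) (trans (cong (dot s x xor_) rx) (xor-identityʳ (dot s x)))

annihilates-flipAt : ∀ {m} rs (x : Vec Bool m) p → All (λ s → nth s p ≡ false) rs →
                     annihilates rs (toList (flipAt p x)) ≡ annihilates rs (toList x)
annihilates-flipAt []       x p []         = refl
annihilates-flipAt (s ∷ rs) x p (sp ∷ sps) =
  cong₂ (λ d a → not d ∧ a) (dot-flipAt-off s x p sp) (annihilates-flipAt rs x p sps)

annihilates-elimRow : ∀ {m} p r rs x → length r ≡ m → All (λ s → length s ≡ m) rs → dot r x ≡ false →
                      annihilates (map (elimRow p r) rs) x ≡ annihilates rs x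
annihilates-elimRow p r []       x lr []         rx = refl
annihilates-elimRow p r (s ∷ rs) x lr (ls ∷ lss) rx =
  cong₂ (λ d a → not d ∧ a) (elimRow-dot p r s x (trans ls (sym lr)) rx) (annihilates-elimRow p r rs x lr lss rx)

solutions : ∀ m → List (List Bool) → ℕ
solutions m rs = # {m} (λ x → annihilates rs (toList x))

-- Flipping coordinate p negates ⟨r, x⟩ and fixes the rows eliminated against the pivot (p, r), so
-- exactly half of the solutions of the eliminated system solve the original one.
solutions-elimRow : ∀ {m} p r rs → length r ≡ m → All (λ s → length s ≡ m) rs → nth r p ≡ true →
                    solutions m (map (elimRow p r) rs) ≡ 2 * solutions m (r ∷ rs)
solutions-elimRow {m} p r rs lr lrs rp = begin
  solutions m rs′
    ≡⟨ #-involution-halves {m} (flipAt p) (flipAt-involutive p)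
         (λ x → dot r (toList x)) (λ x → annihilates rs′ (toList x))
         (λ x → dot-flipAt-pivot r x p lr rp) (λ x → annihilates-flipAt rs′ x p pivots) ⟩
  2 * # {m} (λ x → not (dot r (toList x)) ∧ annihilates rs′ (toList x))
    ≡⟨ cong (2 *_) (#-cong {m} (λ x → eliminate (toList x))) ⟩
  2 * solutions m (r ∷ rs)
    ∎
  where
  rs′ = map (elimRow p r) rs
  pivots : All (λ s → nth s p ≡ false) rs′
  pivots = All.map⁺ (All.map (λ {s} ls → elimRow-pivot p r s rp (trans ls (sym lr))) lrs)
  eliminate : ∀ x → not (dot r x) ∧ annihilates rs′ x ≡ annihilates (r ∷ rs) x
  eliminate x with dot r x in rx
  ... | true  = refl
  ... | false = annihilates-elimRow p r rs x lr lrs rx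

solutions-rankFuel : ∀ {m} f rs → length rs ≡ f → All (λ r → length r ≡ m) rs →
                     solutions m rs * 2 ^ rankFuel f rs ≡ 2 ^ m
solutions-rankFuel {m} zero    []       _   []         = trans (*-identityʳ (solutions m [])) (#-true {m})
solutions-rankFuel {m} (suc f) (r ∷ rs) len (lr ∷ lrs) with firstOne r in fr
... | nothing = trans (cong (_* 2 ^ rankFuel f rs) (#-cong {m} (λ x → cong (λ d → not d ∧ annihilates rs (toList x))
                                                                             (firstOne-nothing r (toList x) fr))))
                      (solutions-rankFuel f rs (cong pred len) lrs)
... | just p = begin
  solutions m (r ∷ rs) * (2 * 2 ^ rankFuel f rs′)
    ≡⟨ sym (*-assoc (solutions m (r ∷ rs)) 2 _) ⟩
  solutions m (r ∷ rs) * 2 * 2 ^ rankFuel f rs′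
    ≡⟨ cong (_* 2 ^ rankFuel f rs′) (trans (*-comm (solutions m (r ∷ rs)) 2)
                                           (sym (solutions-elimRow p r rs lr lrs (firstOne-just r fr)))) ⟩
  solutions m rs′ * 2 ^ rankFuel f rs′
    ≡⟨ solutions-rankFuel f rs′ (trans (List.length-map _ rs) (cong pred len))
                                (All.map⁺ (All.map (λ {s} ls → elimRow-length p r s lr ls) lrs)) ⟩
  2 ^ m
    ∎
  where rs′ = map (elimRow p r) rs

rankFuel-≤ : ∀ f rs → rankFuel f rs ≤ f
rankFuel-≤ zero    rs       = z≤n
rankFuel-≤ (suc f) []       = z≤n
rankFuel-≤ (suc f) (r ∷ rs) with firstOne r
... | nothing = m≤n⇒m≤1+n (rankFuel-≤ f rs)
... | just p  = s≤s (rankFuel-≤ f (map (elimRow p r) rs))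

-- A vector of F₂ⁿ is identified with its support; inKernel A Z y says that y ∈ ker A[Z].
_·_ : Mat n → Subset n → Fin n → Bool
(A · y) i = sumOver ⊤ (λ j → A i j ∧ j ∈ᵇ y)

kernelCondition : Bool → Bool → Bool → Bool
kernelCondition y z a = (not y ∨ z) ∧ (not z ∨ not a)

kernelCondition-exchange : ∀ x z y a →
  kernelCondition y z a ≡ kernelCondition (if x then a else y) (z xor x) (if x then y else a)
kernelCondition-exchange false z     y     a     rewrite xor-identityʳ z = refl
kernelCondition-exchange true  false false false = refl
kernelCondition-exchange true  false false true  = refl
kernelCondition-exchange true  false true  false = refl
kernelCondition-exchange true  false true  true  = refl
kernelCondition-exchange true  true  false false = refl
kernelCondition-exchange true  true  false true  = refl
kernelCondition-exchange true  true  true  false = refl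
kernelCondition-exchange true  true  true  true  = refl

inKernel : Mat n → Subset n → Subset n → Bool
inKernel A Z y = allᵇ (λ i → kernelCondition (i ∈ᵇ y) (i ∈ᵇ Z) ((A · y) i))

kernelSize : Mat n → Subset n → ℕ
kernelSize A Z = # (inKernel A Z)

#-restrict : (Z : Subset n) {m : ℕ} → length (elems Z) ≡ m → (P : List Bool → Bool) →
             # {m} (λ x → P (toList x)) ≡ # (λ y → y ⊆ᵇ Z ∧ P (map (lookup y) (elems Z)))
#-restrict []          refl P = refl
#-restrict {suc n} (false ∷ Z) {m} len P = begin
  # {m} (λ x → P (toList x))
    ≡⟨ #-restrict Z (trans (sym (List.length-map suc (elems Z))) len) P ⟩
  # (λ y → y ⊆ᵇ Z ∧ P (map (lookup y) (elems Z)))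
    ≡⟨ sym (+-identityʳ _) ⟩
  # (λ y → y ⊆ᵇ Z ∧ P (map (lookup y) (elems Z))) + 0
    ≡⟨ cong₂ _+_ (#-cong (λ y → cong (λ l → y ⊆ᵇ Z ∧ P l) (List.map-∘ (elems Z)))) (sym (∑-zero {n})) ⟩
  # (λ y → y ⊆ᵇ Z ∧ P (map (lookup (false ∷ y)) (map suc (elems Z)))) + ∑ {n} (λ _ → 0)
    ∎
#-restrict (true ∷ Z) {suc m} len P = cong₂ _+_ (restrictAt false) (restrictAt true)
  where
  restrictAt : ∀ b → # {m} (λ x → P (b ∷ toList x)) ≡
                     # (λ y → y ⊆ᵇ Z ∧ P (b ∷ map (lookup (b ∷ y)) (map suc (elems Z))))
  restrictAt b = trans (#-restrict Z (trans (sym (List.length-map suc (elems Z))) (cong pred len)) (λ l → P (b ∷ l)))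
                       (#-cong (λ y → cong (λ l → y ⊆ᵇ Z ∧ P (b ∷ l)) (List.map-∘ (elems Z))))

rowsOn : Mat n → Subset n → List (List Bool)
rowsOn A Z = map (λ i → map (λ j → A i j) (elems Z)) (elems Z)

dot-map : (f g : Fin n → Bool) (E : List (Fin n)) →
          dot (map f E) (map g E) ≡ foldr (λ k b → (f k ∧ g k) xor b) false E
dot-map f g []      = refl
dot-map f g (k ∷ E) = cong ((f k ∧ g k) xor_) (dot-map f g E)

annihilates-map : (g : Fin n → List Bool) (E : List (Fin n)) (x : List Bool) →
                  annihilates (map g E) x ≡ foldr (λ i b → not (dot (g i) x) ∧ b) true E
annihilates-map g []      x = refl
annihilates-map g (i ∷ E) x = cong (not (dot (g i) x) ∧_) (annihilates-map g E x)

inKernel-annihilates : (A : Mat n) (Z y : Subset n) →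
                       inKernel A Z y ≡ y ⊆ᵇ Z ∧ annihilates (rowsOn A Z) (map (lookup y) (elems Z))
inKernel-annihilates A Z y = begin
  inKernel A Z y
    ≡⟨ allᵇ-∧ (λ i → not (i ∈ᵇ y) ∨ i ∈ᵇ Z) (λ i → not (i ∈ᵇ Z) ∨ not ((A · y) i)) ⟩
  y ⊆ᵇ Z ∧ allᵇ (λ i → not (i ∈ᵇ Z) ∨ not ((A · y) i))
    ≡⟨ ∧-cong-when (y ⊆ᵇ Z) onSupport ⟩
  y ⊆ᵇ Z ∧ annihilates (rowsOn A Z) (map (lookup y) (elems Z))
    ∎
  where
  E = elems Z
  onSupport : y ⊆ᵇ Z ≡ true →
              allᵇ (λ i → not (i ∈ᵇ Z) ∨ not ((A · y) i)) ≡ annihilates (rowsOn A Z) (map (lookup y) E)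
  onSupport y⊆Z = begin
    allᵇ (λ i → not (i ∈ᵇ Z) ∨ not ((A · y) i))
      ≡⟨ allᵇ-cong (λ i → cong (λ s → not (i ∈ᵇ Z) ∨ not s) (sym (sumOver-supported Z _ (λ j j∉Z →
           trans (cong (A i j ∧_) (⊆ᵇ-∉ {Y = y} {Z} y⊆Z j j∉Z)) (∧-zeroʳ (A i j)))))) ⟩
    allᵇ (λ i → not (i ∈ᵇ Z) ∨ not (sumOver Z (λ j → A i j ∧ j ∈ᵇ y)))
      ≡⟨ allᵇ-elems Z _ ⟩
    foldr (λ i b → not (sumOver Z (λ j → A i j ∧ j ∈ᵇ y)) ∧ b) true E
      ≡⟨ sym (trans (annihilates-map _ E _)
                    (List.foldr-cong (λ i b → cong (λ d → not d ∧ b) (dot-map (A i) (lookup y) E)) refl E)) ⟩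
    annihilates (rowsOn A Z) (map (lookup y) E)
      ∎

kernelSize-rank : (A : Mat n) (Z : Subset n) → kernelSize A Z * 2 ^ rank (rowsOn A Z) ≡ 2 ^ length (elems Z)
kernelSize-rank A Z = begin
  kernelSize A Z * 2 ^ rank (rowsOn A Z)
    ≡⟨ cong (_* 2 ^ rank (rowsOn A Z)) (trans (#-cong (inKernel-annihilates A Z))
                                              (sym (#-restrict Z refl (annihilates (rowsOn A Z))))) ⟩
  solutions (length (elems Z)) (rowsOn A Z) * 2 ^ rank (rowsOn A Z)
    ≡⟨ solutions-rankFuel _ (rowsOn A Z) refl
         (All.map⁺ (All.universal (λ i → List.length-map (A i) (elems Z)) (elems Z))) ⟩
  2 ^ length (elems Z)
    ∎

kernelSize≡2^nullity : (A : Mat n) (Z : Subset n) → kernelSize A Z ≡ 2 ^ nullityOn A Z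
kernelSize≡2^nullity A Z = *-cancelʳ-≡ (kernelSize A Z) (2 ^ (m ∸ r)) (2 ^ r) {{m^n≢0 2 r}} (begin
  kernelSize A Z * 2 ^ r ≡⟨ kernelSize-rank A Z ⟩
  2 ^ m                  ≡⟨ cong (2 ^_) (sym (m∸n+n≡m r≤m)) ⟩
  2 ^ (m ∸ r + r)        ≡⟨ ^-distribˡ-+-* 2 (m ∸ r) r ⟩
  2 ^ (m ∸ r) * 2 ^ r    ∎)
  where
  m = length (elems Z)
  r = rank (rowsOn A Z)
  r≤m : r ≤ m
  r≤m = subst (r ≤_) (List.length-map _ (elems Z)) (rankFuel-≤ _ (rowsOn A Z))

nullityOn-kernelSize : (A B : Mat n) (Z Z′ : Subset n) →
                       kernelSize A Z ≡ kernelSize B Z′ → nullityOn A Z ≡ nullityOn B Z′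
nullityOn-kernelSize A B Z Z′ e = begin
  nullityOn A Z
    ≡⟨ sym (⌊log₂[2^n]⌋≡n _) ⟩
  ⌊log₂ 2 ^ nullityOn A Z ⌋
    ≡⟨ cong ⌊log₂_⌋ (trans (sym (kernelSize≡2^nullity A Z)) (trans e (kernelSize≡2^nullity B Z′))) ⟩
  ⌊log₂ 2 ^ nullityOn B Z′ ⌋
    ≡⟨ ⌊log₂[2^n]⌋≡n _ ⟩
  nullityOn B Z′
    ∎

_≐⟨_⟩_ : Mat n → Subset n → Mat n → Set
A ≐⟨ Z ⟩ B = ∀ i j → i ∈ᵇ Z ≡ true → j ∈ᵇ Z ≡ true → A i j ≡ B i j

elems-∈ : (Z : Subset n) → All (λ i → i ∈ᵇ Z ≡ true) (elems Z)
elems-∈ []          = []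
elems-∈ (true ∷ Z)  = refl ∷ All.map⁺ (elems-∈ Z)
elems-∈ (false ∷ Z) = All.map⁺ (elems-∈ Z)

nullityOn-cong : {A B : Mat n} (Z : Subset n) → A ≐⟨ Z ⟩ B → nullityOn A Z ≡ nullityOn B Z
nullityOn-cong Z A≐B = cong (λ rs → length (elems Z) ∸ rank rs) (List.map-cong-local (All.map
  (λ i∈Z → List.map-cong-local (All.map (λ j∈Z → A≐B _ _ i∈Z j∈Z) (elems-∈ Z))) (elems-∈ Z)))

-- The principal pivot transform preserves nullities

_⊗⟨_⟩_ : Mat n → Subset n → Mat n → Mat n
(M ⊗⟨ X ⟩ N) i j = sumOver X (λ k → M i k ∧ N k j)

⊗-assoc : (M N K : Mat n) (X : Subset n) (i j : Fin n) →
          (M ⊗⟨ X ⟩ (N ⊗⟨ X ⟩ K)) i j ≡ ((M ⊗⟨ X ⟩ N) ⊗⟨ X ⟩ K) i j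
⊗-assoc M N K X i j = sumOver-assoc X X (M i) N (λ l → K l j)

⊗-identityʳ-on : (M N : Mat n) (X : Subset n) → N ≐⟨ X ⟩ δ →
                 ∀ i {l} → l ∈ᵇ X ≡ true → (M ⊗⟨ X ⟩ N) i l ≡ M i l
⊗-identityʳ-on M N X N≡δ i l∈X =
  trans (sumOver-cong X (λ k k∈X → cong (M i k ∧_) (N≡δ k _ k∈X l∈X))) (sumOver-δʳ X (M i) l∈X)

⊗-identityˡ-on : (M N : Mat n) (X : Subset n) → M ≐⟨ X ⟩ δ →
                 ∀ {i} l → i ∈ᵇ X ≡ true → (M ⊗⟨ X ⟩ N) i l ≡ N i l
⊗-identityˡ-on M N X M≡δ l i∈X =
  trans (sumOver-cong X (λ k k∈X → cong (_∧ N k l) (M≡δ _ k i∈X k∈X))) (sumOver-δ X (λ k → N k l) i∈X)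

⊗-· : (M N : Mat n) (X y : Subset n) (i : Fin n) →
      sumOver X (λ j → M i j ∧ (N · y) j) ≡ ((M ⊗⟨ X ⟩ N) · y) i
⊗-· M N X y i = sumOver-assoc X ⊤ (M i) N (λ l → l ∈ᵇ y)

sumOver-identityRow : (M : Mat n) (X y : Subset n) {i : Fin n} → i ∈ᵇ X ≡ true →
                      (∀ l → l ∈ᵇ X ≡ true → M i l ≡ δ i l) →
                      sumOver X (λ l → M i l ∧ l ∈ᵇ y) ≡ i ∈ᵇ y
sumOver-identityRow M X y i∈X M≡δ =
  trans (sumOver-cong X (λ l l∈X → cong (_∧ l ∈ᵇ y) (M≡δ l l∈X))) (sumOver-δ X (lookup y) i∈X)

exchange : Subset n → (Fin n → Bool) → Subset n → Subset n
exchange X w y = tabulate (λ i → if i ∈ᵇ X then w i else i ∈ᵇ y)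

∈-exchange : (X : Subset n) (w : Fin n → Bool) (y : Subset n) (i : Fin n) →
             i ∈ᵇ exchange X w y ≡ (if i ∈ᵇ X then w i else i ∈ᵇ y)
∈-exchange X w y = lookup∘tabulate _

·-exchange : (M : Mat n) (X : Subset n) (w : Fin n → Bool) (y : Subset n) (i : Fin n) →
             (M · exchange X w y) i ≡ sumOver X (λ j → M i j ∧ w j) xor sumOver (∁ X) (λ j → M i j ∧ j ∈ᵇ y)
·-exchange M X w y i = trans (sumOver-split X (λ j → M i j ∧ j ∈ᵇ exchange X w y)) (cong₂ _xor_
  (sumOver-cong X (λ j j∈X → cong (M i j ∧_) (trans (∈-exchange X w y j) (cong (choose j) j∈X))))
  (sumOver-cong (∁ X) (λ j j∈∁X →
     cong (M i j ∧_) (trans (∈-exchange X w y j) (cong (choose j) (∈∁⇒∉ X j j∈∁X))))))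
  where
  choose : ∀ j → Bool → Bool
  choose j x = if x then w j else j ∈ᵇ y

module _ (A : Mat n) (X : Subset n) (Q : Mat n) {i j : Fin n} where

  pptEntry-in-in : i ∈ᵇ X ≡ true → j ∈ᵇ X ≡ true → pptEntry A X Q i j ≡ Q i j
  pptEntry-in-in i∈X j∈X rewrite i∈X | j∈X = refl

  pptEntry-in-out : i ∈ᵇ X ≡ true → j ∈ᵇ X ≡ false → pptEntry A X Q i j ≡ (Q ⊗⟨ X ⟩ A) i j
  pptEntry-in-out i∈X j∉X rewrite i∈X | j∉X = refl

  pptEntry-out-in : i ∈ᵇ X ≡ false → j ∈ᵇ X ≡ true → pptEntry A X Q i j ≡ (A ⊗⟨ X ⟩ Q) i j
  pptEntry-out-in i∉X j∈X rewrite i∉X | j∈X = refl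

  pptEntry-out-out : i ∈ᵇ X ≡ false → j ∈ᵇ X ≡ false →
                     pptEntry A X Q i j ≡ A i j xor (A ⊗⟨ X ⟩ (Q ⊗⟨ X ⟩ A)) i j
  pptEntry-out-out i∉X j∉X rewrite i∉X | j∉X =
    cong (A i j xor_) (sumOver-cong X (λ k _ → sumOver-∧ˡ X (A i k) (λ l → Q k l ∧ A l j)))

-- B = A * X maps exchange X (A · y) y to the vector carrying the X-coordinates of y and the
-- other coordinates of A y (B·φ below), so φ carries ker A[Z] bijectively onto ker B[Z Δ X].
module Pivot {A : Mat n} {X : Subset n} {Pinv : Mat n} (inv : IsInverseOn A X Pinv) where

  B : Mat n
  B = pptEntry A X Pinv

  A⊗Pinv≡δ : (A ⊗⟨ X ⟩ Pinv) ≐⟨ X ⟩ δ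
  A⊗Pinv≡δ = proj₁ inv

  Pinv⊗A≡δ : (Pinv ⊗⟨ X ⟩ A) ≐⟨ X ⟩ δ
  Pinv⊗A≡δ = proj₂ inv

  B·exchange-in : (y : Subset n) {i : Fin n} → i ∈ᵇ X ≡ true → (B · exchange X (A · y) y) i ≡ i ∈ᵇ y
  B·exchange-in y {i} i∈X = begin
    (B · exchange X (A · y) y) i
      ≡⟨ ·-exchange B X (A · y) y i ⟩
    sumOver X (λ j → B i j ∧ (A · y) j) xor sumOver (∁ X) (λ j → B i j ∧ j ∈ᵇ y)
      ≡⟨ cong₂ _xor_
           (sumOver-cong X (λ j j∈X → cong (_∧ (A · y) j) (pptEntry-in-in A X Pinv i∈X j∈X)))
           (sumOver-cong (∁ X) (λ j j∈∁X →
              cong (_∧ j ∈ᵇ y) (pptEntry-in-out A X Pinv i∈X (∈∁⇒∉ X j j∈∁X)))) ⟩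
    sumOver X (λ j → Pinv i j ∧ (A · y) j) xor T
      ≡⟨ cong (_xor T) (trans (⊗-· Pinv A X y i) (sumOver-split X (λ l → (Pinv ⊗⟨ X ⟩ A) i l ∧ l ∈ᵇ y))) ⟩
    (sumOver X (λ l → (Pinv ⊗⟨ X ⟩ A) i l ∧ l ∈ᵇ y) xor T) xor T
      ≡⟨ cong (λ s → (s xor T) xor T)
              (sumOver-identityRow (Pinv ⊗⟨ X ⟩ A) X y i∈X (λ l l∈X → Pinv⊗A≡δ i l i∈X l∈X)) ⟩
    (i ∈ᵇ y xor T) xor T
      ≡⟨ solve 2 (λ a t → (a :+ t) :+ t := a) refl (i ∈ᵇ y) T ⟩
    i ∈ᵇ y ∎
    where T = sumOver (∁ X) (λ l → (Pinv ⊗⟨ X ⟩ A) i l ∧ l ∈ᵇ y)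

  B·exchange-out : (y : Subset n) {i : Fin n} → i ∈ᵇ X ≡ false → (B · exchange X (A · y) y) i ≡ (A · y) i
  B·exchange-out y {i} i∉X = begin
    (B · exchange X (A · y) y) i
      ≡⟨ ·-exchange B X (A · y) y i ⟩
    sumOver X (λ j → B i j ∧ (A · y) j) xor sumOver (∁ X) (λ j → B i j ∧ j ∈ᵇ y)
      ≡⟨ cong₂ _xor_
           (sumOver-cong X (λ j j∈X → cong (_∧ (A · y) j) (pptEntry-out-in A X Pinv i∉X j∈X)))
           (sumOver-cong (∁ X) (λ j j∈∁X →
              cong (_∧ j ∈ᵇ y) (pptEntry-out-out A X Pinv i∉X (∈∁⇒∉ X j j∈∁X)))) ⟩
    sumOver X (λ j → (A ⊗⟨ X ⟩ Pinv) i j ∧ (A · y) j) xor sumOver (∁ X) (λ j → (A i j xor E j) ∧ j ∈ᵇ y)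
      ≡⟨ cong₂ _xor_ first second ⟩
    (sumOver X (λ l → A i l ∧ l ∈ᵇ y) xor T) xor (sumOver (∁ X) (λ l → A i l ∧ l ∈ᵇ y) xor T)
      ≡⟨ solve 3 (λ a b t → (a :+ t) :+ (b :+ t) := a :+ b) refl
           (sumOver X (λ l → A i l ∧ l ∈ᵇ y)) (sumOver (∁ X) (λ l → A i l ∧ l ∈ᵇ y)) T ⟩
    sumOver X (λ l → A i l ∧ l ∈ᵇ y) xor sumOver (∁ X) (λ l → A i l ∧ l ∈ᵇ y)
      ≡⟨ sym (sumOver-split X (λ l → A i l ∧ l ∈ᵇ y)) ⟩
    (A · y) i ∎
    where
    E : Fin n → Bool
    E = (A ⊗⟨ X ⟩ (Pinv ⊗⟨ X ⟩ A)) i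
    T = sumOver (∁ X) (λ l → E l ∧ l ∈ᵇ y)
    first : sumOver X (λ j → (A ⊗⟨ X ⟩ Pinv) i j ∧ (A · y) j) ≡ sumOver X (λ l → A i l ∧ l ∈ᵇ y) xor T
    first = begin
      sumOver X (λ j → (A ⊗⟨ X ⟩ Pinv) i j ∧ (A · y) j)
        ≡⟨ ⊗-· (A ⊗⟨ X ⟩ Pinv) A X y i ⟩
      (((A ⊗⟨ X ⟩ Pinv) ⊗⟨ X ⟩ A) · y) i
        ≡⟨ sumOver-cong ⊤ (λ l _ → cong (_∧ l ∈ᵇ y) (sym (⊗-assoc A Pinv A X i l))) ⟩
      sumOver ⊤ (λ l → E l ∧ l ∈ᵇ y)
        ≡⟨ sumOver-split X (λ l → E l ∧ l ∈ᵇ y) ⟩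
      sumOver X (λ l → E l ∧ l ∈ᵇ y) xor T
        ≡⟨ cong (_xor T) (sumOver-cong X (λ l l∈X →
             cong (_∧ l ∈ᵇ y) (⊗-identityʳ-on A (Pinv ⊗⟨ X ⟩ A) X Pinv⊗A≡δ i l∈X))) ⟩
      sumOver X (λ l → A i l ∧ l ∈ᵇ y) xor T ∎
    second : sumOver (∁ X) (λ j → (A i j xor E j) ∧ j ∈ᵇ y) ≡ sumOver (∁ X) (λ l → A i l ∧ l ∈ᵇ y) xor T
    second = trans (sumOver-cong (∁ X) (λ j _ → ∧-distribʳ-xor (j ∈ᵇ y) (A i j) (E j)))
                   (sumOver-xor (∁ X) (λ l → A i l ∧ l ∈ᵇ y) (λ l → E l ∧ l ∈ᵇ y))

  A·exchange-in : (z : Subset n) {i : Fin n} → i ∈ᵇ X ≡ true → (A · exchange X (B · z) z) i ≡ i ∈ᵇ z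
  A·exchange-in z {i} i∈X = begin
    (A · exchange X (B · z) z) i
      ≡⟨ ·-exchange A X (B · z) z i ⟩
    sumOver X (λ j → A i j ∧ (B · z) j) xor S
      ≡⟨ cong (_xor S) (trans (⊗-· A B X z i) (sumOver-split X (λ l → (A ⊗⟨ X ⟩ B) i l ∧ l ∈ᵇ z))) ⟩
    (sumOver X (λ l → (A ⊗⟨ X ⟩ B) i l ∧ l ∈ᵇ z) xor R) xor S
      ≡⟨ cong (λ s → (s xor R) xor S) (sumOver-identityRow (A ⊗⟨ X ⟩ B) X z i∈X onX) ⟩
    (i ∈ᵇ z xor R) xor S
      ≡⟨ cong (λ s → (i ∈ᵇ z xor s) xor S)
              (sumOver-cong (∁ X) (λ l l∈∁X → cong (_∧ l ∈ᵇ z) (offX l (∈∁⇒∉ X l l∈∁X)))) ⟩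
    (i ∈ᵇ z xor S) xor S
      ≡⟨ solve 2 (λ a s → (a :+ s) :+ s := a) refl (i ∈ᵇ z) S ⟩
    i ∈ᵇ z ∎
    where
    R = sumOver (∁ X) (λ l → (A ⊗⟨ X ⟩ B) i l ∧ l ∈ᵇ z)
    S = sumOver (∁ X) (λ l → A i l ∧ l ∈ᵇ z)
    onX : ∀ l → l ∈ᵇ X ≡ true → (A ⊗⟨ X ⟩ B) i l ≡ δ i l
    onX l l∈X =
      trans (sumOver-cong X (λ k k∈X → cong (A i k ∧_) (pptEntry-in-in A X Pinv k∈X l∈X)))
            (A⊗Pinv≡δ i l i∈X l∈X)
    offX : ∀ l → l ∈ᵇ X ≡ false → (A ⊗⟨ X ⟩ B) i l ≡ A i l
    offX l l∉X = begin
      (A ⊗⟨ X ⟩ B) i l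
        ≡⟨ sumOver-cong X (λ k k∈X → cong (A i k ∧_) (pptEntry-in-out A X Pinv k∈X l∉X)) ⟩
      (A ⊗⟨ X ⟩ (Pinv ⊗⟨ X ⟩ A)) i l
        ≡⟨ ⊗-assoc A Pinv A X i l ⟩
      ((A ⊗⟨ X ⟩ Pinv) ⊗⟨ X ⟩ A) i l
        ≡⟨ ⊗-identityˡ-on (A ⊗⟨ X ⟩ Pinv) A X A⊗Pinv≡δ l i∈X ⟩
      A i l
        ∎

  φ ψ : Subset n → Subset n
  φ y = exchange X (A · y) y
  ψ z = exchange X (B · z) z

  B·φ : (y : Subset n) (i : Fin n) → (B · φ y) i ≡ (if i ∈ᵇ X then i ∈ᵇ y else (A · y) i)
  B·φ y i = byMembership (i ∈ᵇ X) refl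
    where
    byMembership : ∀ x → i ∈ᵇ X ≡ x → (B · φ y) i ≡ (if x then i ∈ᵇ y else (A · y) i)
    byMembership true  i∈X = B·exchange-in y i∈X
    byMembership false i∉X = B·exchange-out y i∉X

  ψ∘φ : (y : Subset n) → ψ (φ y) ≡ y
  ψ∘φ y = lookup-ext λ i → trans (∈-exchange X (B · φ y) (φ y) i) (byMembership i (i ∈ᵇ X) refl)
    where
    byMembership : ∀ i x → i ∈ᵇ X ≡ x → (if x then (B · φ y) i else i ∈ᵇ φ y) ≡ i ∈ᵇ y
    byMembership i true  i∈X = B·exchange-in y i∈X
    byMembership i false i∉X = trans (∈-exchange X (A · y) y i) (cong (if_then (A · y) i else i ∈ᵇ y) i∉X)

  φ∘ψ : (z : Subset n) → φ (ψ z) ≡ z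
  φ∘ψ z = lookup-ext λ i → trans (∈-exchange X (A · ψ z) (ψ z) i) (byMembership i (i ∈ᵇ X) refl)
    where
    byMembership : ∀ i x → i ∈ᵇ X ≡ x → (if x then (A · ψ z) i else i ∈ᵇ ψ z) ≡ i ∈ᵇ z
    byMembership i true  i∈X = A·exchange-in z i∈X
    byMembership i false i∉X = trans (∈-exchange X (B · z) z i) (cong (if_then (B · z) i else i ∈ᵇ z) i∉X)

  inKernel-φ : (Z y : Subset n) → inKernel A Z y ≡ inKernel B (Z Δ X) (φ y)
  inKernel-φ Z y = allᵇ-cong coordinate
    where
    coordinate : ∀ i → kernelCondition (i ∈ᵇ y) (i ∈ᵇ Z) ((A · y) i) ≡
                       kernelCondition (i ∈ᵇ φ y) (i ∈ᵇ (Z Δ X)) ((B · φ y) i)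
    coordinate i = begin
      kernelCondition (i ∈ᵇ y) (i ∈ᵇ Z) ((A · y) i)
        ≡⟨ kernelCondition-exchange (i ∈ᵇ X) (i ∈ᵇ Z) (i ∈ᵇ y) ((A · y) i) ⟩
      kernelCondition (if i ∈ᵇ X then (A · y) i else i ∈ᵇ y) (i ∈ᵇ Z xor i ∈ᵇ X)
                      (if i ∈ᵇ X then i ∈ᵇ y else (A · y) i)
        ≡⟨ cong₂ (λ a b → kernelCondition a b (if i ∈ᵇ X then i ∈ᵇ y else (A · y) i))
                 (sym (∈-exchange X (A · y) y i)) (sym (∈-Δ Z X i)) ⟩
      kernelCondition (i ∈ᵇ φ y) (i ∈ᵇ (Z Δ X)) (if i ∈ᵇ X then i ∈ᵇ y else (A · y) i)
        ≡⟨ cong (kernelCondition (i ∈ᵇ φ y) (i ∈ᵇ (Z Δ X))) (sym (B·φ y i)) ⟩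
      kernelCondition (i ∈ᵇ φ y) (i ∈ᵇ (Z Δ X)) ((B · φ y) i)
        ∎

  kernelSize-pivot : (Z : Subset n) → kernelSize A Z ≡ kernelSize B (Z Δ X)
  kernelSize-pivot Z =
    trans (#-cong (inKernel-φ Z)) (∑-bijection φ ψ ψ∘φ φ∘ψ (λ y → ⟦ inKernel B (Z Δ X) y ⟧))

nullityOn-pivot : {A : Mat n} {X : Subset n} {Pinv : Mat n} → IsInverseOn A X Pinv →
                  (Z : Subset n) → nullityOn A Z ≡ nullityOn (pptEntry A X Pinv) (Z Δ X)
nullityOn-pivot {A = A} {X} {Pinv} inv Z =
  nullityOn-kernelSize A (pptEntry A X Pinv) Z (Z Δ X) (Pivot.kernelSize-pivot inv Z)

IsInverseOn-cong : {A A′ : Mat n} {X : Subset n} {Pinv : Mat n} →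
                   A ≐⟨ X ⟩ A′ → IsInverseOn A X Pinv → IsInverseOn A′ X Pinv
IsInverseOn-cong {X = X} {Pinv} A≐A′ (A⊗P≡δ , P⊗A≡δ) =
  (λ i j i∈X j∈X →
     trans (sumOver-cong X (λ k k∈X → cong (_∧ Pinv k j) (sym (A≐A′ i k i∈X k∈X)))) (A⊗P≡δ i j i∈X j∈X)) ,
  (λ i j i∈X j∈X →
     trans (sumOver-cong X (λ k k∈X → cong (Pinv i k ∧_) (sym (A≐A′ k j k∈X j∈X)))) (P⊗A≡δ i j i∈X j∈X))

nullityOn-IsPivot : {A B : Mat n} {X : Subset n} → IsPivot A X B →
                    (Z : Subset n) → nullityOn A Z ≡ nullityOn B (Z Δ X)
nullityOn-IsPivot {A = A} {B} {X} (Pinv , inv , B≡) Z =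
  trans (nullityOn-pivot {X = X} {Pinv} inv Z) (nullityOn-cong (Z Δ X) (λ i j _ _ → sym (B≡ i j)))

-- Loop complementation

+ᴸ-∉ : (A : Mat n) (W : Subset n) {i : Fin n} (j : Fin n) → i ∈ᵇ W ≡ false → (A +ᴸ W) i j ≡ A i j
+ᴸ-∉ A W {i} j i∉W rewrite i∉W | ∧-zeroʳ (δ i j) = xor-identityʳ (A i j)

+ᴸ-offDiagonal : (A : Mat n) (W : Subset n) {i j : Fin n} → δ i j ≡ false → (A +ᴸ W) i j ≡ A i j
+ᴸ-offDiagonal A W {i} {j} δij rewrite δij = xor-identityʳ (A i j)

+ᴸ-+ᴸ : (A : Mat n) (X Y : Subset n) (i j : Fin n) → ((A +ᴸ X) +ᴸ Y) i j ≡ (A +ᴸ (X Δ Y)) i j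
+ᴸ-+ᴸ A X Y i j rewrite ∈-Δ X Y i =
  solve 4 (λ a d x y → (a :+ d :* x) :+ d :* y := a :+ d :* (x :+ y)) refl (A i j) (δ i j) (i ∈ᵇ X) (i ∈ᵇ Y)

+ᴸ-≗ : (A : Mat n) (X X′ : Subset n) → (∀ i → i ∈ᵇ X ≡ i ∈ᵇ X′) →
       ∀ i j → (A +ᴸ X) i j ≡ (A +ᴸ X′) i j
+ᴸ-≗ A X X′ X≗X′ i j = cong (λ x → A i j xor (δ i j ∧ x)) (X≗X′ i)

pptEntry-+ᴸ : (A : Mat n) (X W : Subset n) (Pinv : Mat n) → (∀ i → i ∈ᵇ X ≡ true → i ∈ᵇ W ≡ false) →
              ∀ i j → pptEntry (A +ᴸ W) X Pinv i j ≡ (pptEntry A X Pinv +ᴸ W) i j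
pptEntry-+ᴸ A X W Pinv X∩W≡∅ i j = byMembership (i ∈ᵇ X) (j ∈ᵇ X) refl refl
  where
  A′ = A +ᴸ W
  rowOff : ∀ {k} l → k ∈ᵇ X ≡ true → A′ k l ≡ A k l
  rowOff l k∈X = +ᴸ-∉ A W l (X∩W≡∅ _ k∈X)
  colOff : i ∈ᵇ X ≡ false → ∀ k → k ∈ᵇ X ≡ true → A′ i k ≡ A i k
  colOff i∉X k k∈X = +ᴸ-offDiagonal A W (δ-∉∈ X i∉X k∈X)
  P⊗A′ : ∀ k → (Pinv ⊗⟨ X ⟩ A′) k j ≡ (Pinv ⊗⟨ X ⟩ A) k j
  P⊗A′ k = sumOver-cong X (λ l l∈X → cong (Pinv k l ∧_) (rowOff j l∈X))
  byMembership : ∀ x x′ → i ∈ᵇ X ≡ x → j ∈ᵇ X ≡ x′ →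
                 pptEntry A′ X Pinv i j ≡ (pptEntry A X Pinv +ᴸ W) i j
  byMembership true true i∈X j∈X = begin
    pptEntry A′ X Pinv i j          ≡⟨ pptEntry-in-in A′ X Pinv i∈X j∈X ⟩
    Pinv i j                        ≡⟨ sym (pptEntry-in-in A X Pinv i∈X j∈X) ⟩
    pptEntry A X Pinv i j           ≡⟨ sym (+ᴸ-∉ (pptEntry A X Pinv) W j (X∩W≡∅ i i∈X)) ⟩
    (pptEntry A X Pinv +ᴸ W) i j    ∎
  byMembership true false i∈X j∉X = begin
    pptEntry A′ X Pinv i j          ≡⟨ pptEntry-in-out A′ X Pinv i∈X j∉X ⟩
    (Pinv ⊗⟨ X ⟩ A′) i j            ≡⟨ P⊗A′ i ⟩
    (Pinv ⊗⟨ X ⟩ A) i j             ≡⟨ sym (pptEntry-in-out A X Pinv i∈X j∉X) ⟩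
    pptEntry A X Pinv i j           ≡⟨ sym (+ᴸ-∉ (pptEntry A X Pinv) W j (X∩W≡∅ i i∈X)) ⟩
    (pptEntry A X Pinv +ᴸ W) i j    ∎
  byMembership false true i∉X j∈X = begin
    pptEntry A′ X Pinv i j          ≡⟨ pptEntry-out-in A′ X Pinv i∉X j∈X ⟩
    (A′ ⊗⟨ X ⟩ Pinv) i j            ≡⟨ sumOver-cong X (λ k k∈X → cong (_∧ Pinv k j) (colOff i∉X k k∈X)) ⟩
    (A ⊗⟨ X ⟩ Pinv) i j             ≡⟨ sym (pptEntry-out-in A X Pinv i∉X j∈X) ⟩
    pptEntry A X Pinv i j           ≡⟨ sym (+ᴸ-offDiagonal (pptEntry A X Pinv) W (δ-∉∈ X i∉X j∈X)) ⟩
    (pptEntry A X Pinv +ᴸ W) i j    ∎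
  byMembership false false i∉X j∉X = begin
    pptEntry A′ X Pinv i j
      ≡⟨ pptEntry-out-out A′ X Pinv i∉X j∉X ⟩
    A′ i j xor (A′ ⊗⟨ X ⟩ (Pinv ⊗⟨ X ⟩ A′)) i j
      ≡⟨ cong (A′ i j xor_) (sumOver-cong X (λ k k∈X → cong₂ _∧_ (colOff i∉X k k∈X) (P⊗A′ k))) ⟩
    (A i j xor (δ i j ∧ i ∈ᵇ W)) xor (A ⊗⟨ X ⟩ (Pinv ⊗⟨ X ⟩ A)) i j
      ≡⟨ solve 3 (λ a d e → (a :+ d) :+ e := (a :+ e) :+ d) refl (A i j) (δ i j ∧ i ∈ᵇ W) _ ⟩
    (A i j xor (A ⊗⟨ X ⟩ (Pinv ⊗⟨ X ⟩ A)) i j) xor (δ i j ∧ i ∈ᵇ W)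
      ≡⟨ cong (_xor (δ i j ∧ i ∈ᵇ W)) (sym (pptEntry-out-out A X Pinv i∉X j∉X)) ⟩
    (pptEntry A X Pinv +ᴸ W) i j
      ∎

nullityOn-+ᴸ-IsPivot : {A B : Mat n} {X : Subset n} → IsPivot A X B →
                       (W : Subset n) → (∀ i → i ∈ᵇ X ≡ true → i ∈ᵇ W ≡ false) →
                       (Z : Subset n) → nullityOn (A +ᴸ W) Z ≡ nullityOn (B +ᴸ W) (Z Δ X)
nullityOn-+ᴸ-IsPivot {A = A} {B} {X} (Pinv , inv , B≡) W X∩W≡∅ Z = begin
  nullityOn (A +ᴸ W) Z
    ≡⟨ nullityOn-pivot {X = X} {Pinv} (IsInverseOn-cong {X = X} {Pinv} A≐A+W inv) Z ⟩
  nullityOn (pptEntry (A +ᴸ W) X Pinv) (Z Δ X)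
    ≡⟨ nullityOn-cong (Z Δ X) (λ i j _ _ →
         trans (pptEntry-+ᴸ A X W Pinv X∩W≡∅ i j) (cong (_xor (δ i j ∧ i ∈ᵇ W)) (sym (B≡ i j)))) ⟩
  nullityOn (B +ᴸ W) (Z Δ X)
    ∎
  where
  A≐A+W : A ≐⟨ X ⟩ (A +ᴸ W)
  A≐A+W i j i∈X _ = sym (+ᴸ-∉ A W j (X∩W≡∅ i i∈X))

nullityOn-IsDualPivot : {G GY : Mat n} {Y : Subset n} → IsDualPivot G Y GY →
                        (L : Subset n) → (∀ i → i ∈ᵇ Y ≡ true → i ∈ᵇ L ≡ true) →
                        (Z : Subset n) → nullityOn (G +ᴸ L) Z ≡ nullityOn (GY +ᴸ L) (Z Δ Y)
nullityOn-IsDualPivot {G = G} {GY} {Y} (C , pivot , GY≡) L Y⊆L Z = begin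
  nullityOn (G +ᴸ L) Z
    ≡⟨ nullityOn-cong Z (λ i j _ _ →
         sym (trans (+ᴸ-+ᴸ G Y (L Δ Y) i j) (+ᴸ-≗ G (Y Δ (L Δ Y)) L YΔ[LΔY]≗L i j))) ⟩
  nullityOn ((G +ᴸ Y) +ᴸ (L Δ Y)) Z
    ≡⟨ nullityOn-+ᴸ-IsPivot pivot (L Δ Y) Y∩[LΔY]≡∅ Z ⟩
  nullityOn (C +ᴸ (L Δ Y)) (Z Δ Y)
    ≡⟨ nullityOn-cong (Z Δ Y) (λ i j _ _ → sym (begin
         (GY +ᴸ L) i j         ≡⟨ cong (_xor (δ i j ∧ i ∈ᵇ L)) (GY≡ i j) ⟩
         ((C +ᴸ Y) +ᴸ L) i j   ≡⟨ +ᴸ-+ᴸ C Y L i j ⟩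
         (C +ᴸ (Y Δ L)) i j    ≡⟨ +ᴸ-≗ C (Y Δ L) (L Δ Y) YΔL≗LΔY i j ⟩
         (C +ᴸ (L Δ Y)) i j    ∎)) ⟩
  nullityOn (GY +ᴸ L) (Z Δ Y)
    ∎
  where
  YΔ[LΔY]≗L : ∀ i → i ∈ᵇ (Y Δ (L Δ Y)) ≡ i ∈ᵇ L
  YΔ[LΔY]≗L i rewrite ∈-Δ Y (L Δ Y) i | ∈-Δ L Y i =
    solve 2 (λ y l → y :+ (l :+ y) := l) refl (i ∈ᵇ Y) (i ∈ᵇ L)
  YΔL≗LΔY : ∀ i → i ∈ᵇ (Y Δ L) ≡ i ∈ᵇ (L Δ Y)
  YΔL≗LΔY i rewrite ∈-Δ Y L i | ∈-Δ L Y i = xor-comm (i ∈ᵇ Y) (i ∈ᵇ L)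
  Y∩[LΔY]≡∅ : ∀ i → i ∈ᵇ Y ≡ true → i ∈ᵇ (L Δ Y) ≡ false
  Y∩[LΔY]≡∅ i i∈Y = trans (∈-Δ L Y i) (cong₂ _xor_ (Y⊆L i i∈Y) i∈Y)

nullityOn-+ᴸ-on : (A : Mat n) (L L′ Z : Subset n) → (∀ i → i ∈ᵇ Z ≡ true → i ∈ᵇ L ≡ i ∈ᵇ L′) →
                  nullityOn (A +ᴸ L) Z ≡ nullityOn (A +ᴸ L′) Z
nullityOn-+ᴸ-on A L L′ Z L≗L′ =
  nullityOn-cong Z (λ i j i∈Z _ → cong (λ x → A i j xor (δ i j ∧ x)) (L≗L′ i i∈Z))

nullityOn-+ᴸ⊤ : (A : Mat n) (Z : Subset n) {u : Fin n} → u ∈ᵇ Z ≡ false →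
                nullityOn (A +ᴸ ⊤) Z ≡ nullityOn (A +ᴸ V∖ u) Z
nullityOn-+ᴸ⊤ A Z {u} u∉Z =
  nullityOn-+ᴸ-on A ⊤ (V∖ u) Z (λ i i∈Z → trans (∈-⊤ i) (sym (∉⇒⊆V∖ Z u∉Z i∈Z)))

nullityOn-+ᴸ-Δ⁅⁆ : (A : Mat n) (X Z : Subset n) {a : Fin n} → a ∈ᵇ Z ≡ false →
                   nullityOn (A +ᴸ X) Z ≡ nullityOn (A +ᴸ (X Δ ⁅ a ⁆)) Z
nullityOn-+ᴸ-Δ⁅⁆ A X Z {a} a∉Z =
  nullityOn-+ᴸ-on A X (X Δ ⁅ a ⁆) Z (λ i i∈Z → sym (∈-Δ-∉ X (trans (∈-⁅⁆ a i) (δ-∉∈ Z a∉Z i∈Z))))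

ones : Mat n
ones _ _ = true

inverse-⁅⁆ : (A : Mat n) (a : Fin n) → A a a ≡ true → IsInverseOn A ⁅ a ⁆ ones
inverse-⁅⁆ A a aa = (λ i j i∈ j∈ → right (∈⁅⁆⇒≡ i∈) (∈⁅⁆⇒≡ j∈)) ,
                    (λ i j i∈ j∈ → left (∈⁅⁆⇒≡ i∈) (∈⁅⁆⇒≡ j∈))
  where
  right : ∀ {i j} → a ≡ i → a ≡ j → sumOver ⁅ a ⁆ (λ k → A i k ∧ true) ≡ δ i j
  right refl refl =
    trans (sumOver-⁅⁆ a (λ k → A a k ∧ true)) (trans (trans (∧-identityʳ (A a a)) aa) (sym (δ-refl a)))
  left : ∀ {i j} → a ≡ i → a ≡ j → sumOver ⁅ a ⁆ (λ k → true ∧ A k j) ≡ δ i j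
  left refl refl = trans (sumOver-⁅⁆ a (λ k → A k a)) (trans aa (sym (δ-refl a)))

IsPivot-⁅⁆ : (A : Mat n) (a : Fin n) → A a a ≡ true → IsPivot A ⁅ a ⁆ (pptEntry A ⁅ a ⁆ ones)
IsPivot-⁅⁆ A a aa = ones , inverse-⁅⁆ A a aa , λ _ _ → refl

dualPivot⁅⁆ : Mat n → Fin n → Mat n
dualPivot⁅⁆ G a = pptEntry (G +ᴸ ⁅ a ⁆) ⁅ a ⁆ ones +ᴸ ⁅ a ⁆

IsDualPivot-⁅⁆ : (G : Mat n) (a : Fin n) → G a a ≡ false → IsDualPivot G ⁅ a ⁆ (dualPivot⁅⁆ G a)
IsDualPivot-⁅⁆ G a aa =
  pptEntry (G +ᴸ ⁅ a ⁆) ⁅ a ⁆ ones , IsPivot-⁅⁆ (G +ᴸ ⁅ a ⁆) a loop , λ _ _ → refl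
  where
  loop : (G +ᴸ ⁅ a ⁆) a a ≡ true
  loop rewrite aa | δ-refl a = a∈⁅a⁆ a

pptEntry-⁅⁆ : (A : Mat n) (a : Fin n) {i j : Fin n} → δ a i ≡ false → δ a j ≡ false →
              pptEntry A ⁅ a ⁆ ones i j ≡ A i j xor (A i a ∧ A a j)
pptEntry-⁅⁆ A a {i} {j} ai aj = begin
  pptEntry A ⁅ a ⁆ ones i j
    ≡⟨ pptEntry-out-out A ⁅ a ⁆ ones (trans (∈-⁅⁆ a i) ai) (trans (∈-⁅⁆ a j) aj) ⟩
  A i j xor (A ⊗⟨ ⁅ a ⁆ ⟩ (ones ⊗⟨ ⁅ a ⁆ ⟩ A)) i j
    ≡⟨ cong (A i j xor_) (trans (sumOver-⁅⁆ a (λ k → A i k ∧ (ones ⊗⟨ ⁅ a ⁆ ⟩ A) k j))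
                                (cong (A i a ∧_) (sumOver-⁅⁆ a (λ l → A l j)))) ⟩
  A i j xor (A i a ∧ A a j)
    ∎

dualPivot⁅⁆-entry : (G : Mat n) (a : Fin n) {i j : Fin n} → δ a i ≡ false → δ a j ≡ false →
                    dualPivot⁅⁆ G a i j ≡ G i j xor (G i a ∧ G a j)
dualPivot⁅⁆-entry G a {i} {j} ai aj = begin
  dualPivot⁅⁆ G a i j
    ≡⟨ +ᴸ-∉ (pptEntry (G +ᴸ ⁅ a ⁆) ⁅ a ⁆ ones) ⁅ a ⁆ j i∉ ⟩
  pptEntry (G +ᴸ ⁅ a ⁆) ⁅ a ⁆ ones i j
    ≡⟨ pptEntry-⁅⁆ (G +ᴸ ⁅ a ⁆) a ai aj ⟩
  (G +ᴸ ⁅ a ⁆) i j xor ((G +ᴸ ⁅ a ⁆) i a ∧ (G +ᴸ ⁅ a ⁆) a j)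
    ≡⟨ cong₂ (λ x y → x xor (y ∧ (G +ᴸ ⁅ a ⁆) a j)) (+ᴸ-∉ G ⁅ a ⁆ j i∉) (+ᴸ-∉ G ⁅ a ⁆ a i∉) ⟩
  G i j xor (G i a ∧ (G +ᴸ ⁅ a ⁆) a j)
    ≡⟨ cong (λ x → G i j xor (G i a ∧ x)) (+ᴸ-offDiagonal G ⁅ a ⁆ aj) ⟩
  G i j xor (G i a ∧ G a j)
    ∎
  where
  i∉ : i ∈ᵇ ⁅ a ⁆ ≡ false
  i∉ = trans (∈-⁅⁆ a i) ai

q₁-recurrence : (G : Mat n) (u : Fin n) (X : Subset n) (GX : Mat n) → u ∈ᵇ X ≡ true → IsPivot G X GX →
                ∀ k → q₁ G ⊤ k ≡ (q₁ G (V∖ u) ⊕ q₁ GX (V∖ u)) k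
q₁-recurrence G u X GX u∈X pivot k = begin
  q₁ G ⊤ k
    ≡⟨ count-subsetsOf-⊤ (nullity G) ⟩
  # (nullity G)
    ≡⟨ #-split (u ∈ᵇ_) (nullity G) ⟩
  # (λ Z → not (u ∈ᵇ Z) ∧ nullity G Z) + # (λ Z → u ∈ᵇ Z ∧ nullity G Z)
    ≡⟨ cong₂ _+_ (sym (count-subsetsOf-V∖ u (nullity G)))
                 (trans (#-reindex X shifted) (sym (count-subsetsOf-V∖ u (nullity GX)))) ⟩
  q₁ G (V∖ u) k + q₁ GX (V∖ u) k
    ∎
  where
  nullity : Mat n → Subset n → Bool
  nullity A Z = ℕeq (nullityOn A Z) k
  shifted : ∀ Z → u ∈ᵇ Z ∧ nullity G Z ≡ not (u ∈ᵇ (Z Δ X)) ∧ nullity GX (Z Δ X)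
  shifted Z = cong₂ _∧_ (sym (not-∈-Δ-∈ Z u∈X)) (cong (λ m → ℕeq m k) (nullityOn-IsPivot pivot Z))

q₃-recurrence : (G : Mat n) (u : Fin n) (Y : Subset n) (GY : Mat n) → u ∈ᵇ Y ≡ true → IsDualPivot G Y GY →
                ∀ k → q₃ G ⊤ k ≡ (q₃ G (V∖ u) ⊕ q₃ GY (V∖ u)) k
q₃-recurrence G u Y GY u∈Y dualPivot k = begin
  q₃ G ⊤ k
    ≡⟨ count-subsetsOf-⊤ (nullity G ⊤) ⟩
  # (nullity G ⊤)
    ≡⟨ #-split (u ∈ᵇ_) (nullity G ⊤) ⟩
  # (λ Z → not (u ∈ᵇ Z) ∧ nullity G ⊤ Z) + # (λ Z → u ∈ᵇ Z ∧ nullity G ⊤ Z)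
    ≡⟨ cong₂ _+_ (trans (#-cong unshifted) (sym (count-subsetsOf-V∖ u (nullity G (V∖ u)))))
                 (trans (#-reindex Y shifted) (sym (count-subsetsOf-V∖ u (nullity GY (V∖ u))))) ⟩
  q₃ G (V∖ u) k + q₃ GY (V∖ u) k
    ∎
  where
  nullity : Mat n → Subset n → Subset n → Bool
  nullity A L Z = ℕeq (nullityOn (A +ᴸ L) Z) k
  unshifted : ∀ Z → not (u ∈ᵇ Z) ∧ nullity G ⊤ Z ≡ not (u ∈ᵇ Z) ∧ nullity G (V∖ u) Z
  unshifted Z = not∧-cong-when (u ∈ᵇ Z) (λ u∉Z → cong (λ m → ℕeq m k) (nullityOn-+ᴸ⊤ G Z u∉Z))
  shifted : ∀ Z → u ∈ᵇ Z ∧ nullity G ⊤ Z ≡ not (u ∈ᵇ (Z Δ Y)) ∧ nullity GY (V∖ u) (Z Δ Y)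
  shifted Z = begin
    u ∈ᵇ Z ∧ nullity G ⊤ Z
      ≡⟨ ∧-cong-when (u ∈ᵇ Z) (λ u∈Z → cong (λ m → ℕeq m k) (trans
           (nullityOn-IsDualPivot {G = G} dualPivot ⊤ (λ i _ → ∈-⊤ i) Z)
           (nullityOn-+ᴸ⊤ GY (Z Δ Y) (trans (∈-Δ-∈ Z u∈Y) (cong not u∈Z))))) ⟩
    u ∈ᵇ Z ∧ nullity GY (V∖ u) (Z Δ Y)
      ≡⟨ cong (_∧ nullity GY (V∖ u) (Z Δ Y)) (sym (not-∈-Δ-∈ Z u∈Y)) ⟩
    not (u ∈ᵇ (Z Δ Y)) ∧ nullity GY (V∖ u) (Z Δ Y)
      ∎

module LoopFreeEdge (G : Mat n) (symmetric : Symmetric G) {u v : Fin n}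
                    (uv : G u v ≡ true) (uu : G u u ≡ false) (vv : G v v ≡ false) where

  vu : G v u ≡ true
  vu = trans (symmetric v u) uv

  δuv : δ u v ≡ false
  δuv = δ-≢ u≢v
    where
    u≢v : u ≢ v
    u≢v refl with () ← trans (sym uv) uu

  δvu : δ v u ≡ false
  δvu = trans (δ-sym v u) δuv

  X₂ W : Subset n
  X₂ = ⁅ u ⁆ ∪ ⁅ v ⁆
  W  = V∖₂ u v

  v∈X₂ : v ∈ᵇ X₂ ≡ true
  v∈X₂ = trans (∈-⁅⁆∪⁅⁆ u v v) (trans (cong (δ u v ∨_) (δ-refl v)) (∨-zeroʳ (δ u v)))

  ∈X₂ : ∀ {i} → i ∈ᵇ X₂ ≡ true → u ≡ i ⊎ v ≡ i
  ∈X₂ {i} i∈X₂ with δ u i in ui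
  ... | true  = inj₁ (δ-true⇒≡ ui)
  ... | false = inj₂ (δ-true⇒≡ (trans (sym (cong (_∨ δ v i) ui)) (trans (sym (∈-⁅⁆∪⁅⁆ u v i)) i∈X₂)))

  -- G[{u, v}] is [[0, 1], [1, 0]], its own inverse.
  G-selfInverse : IsInverseOn G X₂ G
  G-selfInverse = square , square
    where
    square : ∀ i j → i ∈ᵇ X₂ ≡ true → j ∈ᵇ X₂ ≡ true → (G ⊗⟨ X₂ ⟩ G) i j ≡ δ i j
    square i j i∈X₂ j∈X₂ = trans (sumOver-pair δuv (λ k → G i k ∧ G k j)) (byCases (∈X₂ i∈X₂) (∈X₂ j∈X₂))
      where
      byCases : u ≡ i ⊎ v ≡ i → u ≡ j ⊎ v ≡ j → (G i u ∧ G u j) xor (G i v ∧ G v j) ≡ δ i j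
      byCases (inj₁ refl) (inj₁ refl) rewrite uu | uv | vu | δ-refl u = refl
      byCases (inj₁ refl) (inj₂ refl) rewrite uu | uv | vv | δuv = refl
      byCases (inj₂ refl) (inj₁ refl) rewrite uu | vu | vv | δvu = refl
      byCases (inj₂ refl) (inj₂ refl) rewrite uv | vu | vv | δ-refl v = refl

  Guv Gv Gvu Gu Guvv : Mat n
  Guv  = pptEntry G X₂ G
  Gv   = dualPivot⁅⁆ G v
  Gvu  = pptEntry Gv ⁅ u ⁆ ones
  Gu   = dualPivot⁅⁆ G u
  Guvv = dualPivot⁅⁆ Guv v

  Guv-pivot : IsPivot G X₂ Guv
  Guv-pivot = G , G-selfInverse , λ _ _ → refl

  Gv-uu : Gv u u ≡ true
  Gv-uu rewrite dualPivot⁅⁆-entry G v δvu δvu | uu | uv | vu = refl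

  Gvu-pivot : IsPivot Gv ⁅ u ⁆ Gvu
  Gvu-pivot = IsPivot-⁅⁆ Gv u Gv-uu

  Guv-vv : Guv v v ≡ false
  Guv-vv = trans (pptEntry-in-in G X₂ G v∈X₂ v∈X₂) vv

  ⊤Δ⁅v⁆Δ⁅u⁆≡W : (⊤ Δ ⁅ v ⁆) Δ ⁅ u ⁆ ≡ W
  ⊤Δ⁅v⁆Δ⁅u⁆≡W = lookup-ext λ i → begin
    i ∈ᵇ ((⊤ Δ ⁅ v ⁆) Δ ⁅ u ⁆)
      ≡⟨ trans (∈-Δ (⊤ Δ ⁅ v ⁆) ⁅ u ⁆ i) (cong₂ _xor_ (trans (∈-Δ ⊤ ⁅ v ⁆ i) (cong₂ _xor_ (∈-⊤ i) (∈-⁅⁆ v i)))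
                                                    (∈-⁅⁆ u i)) ⟩
    not (δ v i) xor δ u i
      ≡⟨ byCases i ⟩
    not (δ u i ∨ δ v i)
      ≡⟨ sym (trans (∈-∁ X₂ i) (cong not (∈-⁅⁆∪⁅⁆ u v i))) ⟩
    i ∈ᵇ W
      ∎
    where
    byCases : ∀ i → not (δ v i) xor δ u i ≡ not (δ u i ∨ δ v i)
    byCases i with δ u i in ui
    ... | true  rewrite sym (δ-true⇒≡ ui) | δvu = refl
    ... | false = xor-identityʳ (not (δ v i))

  nullity-uv : ∀ X → u ∈ᵇ X ≡ false → v ∈ᵇ X ≡ false → nullityOn (G +ᴸ X) ⊤ ≡ nullityOn (Guv +ᴸ X) W
  nullity-uv X u∉X v∉X =
    trans (nullityOn-+ᴸ-IsPivot Guv-pivot X X₂∩X≡∅ ⊤) (cong (nullityOn (Guv +ᴸ X)) (⊤-Δ X₂))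
    where
    X₂∩X≡∅ : ∀ i → i ∈ᵇ X₂ ≡ true → i ∈ᵇ X ≡ false
    X₂∩X≡∅ i i∈X₂ with ∈X₂ i∈X₂
    ... | inj₁ refl = u∉X
    ... | inj₂ refl = v∉X

  nullity-u : ∀ X → u ∈ᵇ X ≡ true → nullityOn (G +ᴸ X) ⊤ ≡ nullityOn (Gu +ᴸ (X Δ ⁅ u ⁆)) (V∖ u)
  nullity-u X u∈X = begin
    nullityOn (G +ᴸ X) ⊤
      ≡⟨ nullityOn-IsDualPivot {G = G} (IsDualPivot-⁅⁆ G u uu) X (∈ᵇ-on-⁅⁆ {a = u} {X} u∈X) ⊤ ⟩
    nullityOn (Gu +ᴸ X) (⊤ Δ ⁅ u ⁆)
      ≡⟨ cong (nullityOn (Gu +ᴸ X)) (⊤-Δ ⁅ u ⁆) ⟩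
    nullityOn (Gu +ᴸ X) (V∖ u)
      ≡⟨ nullityOn-+ᴸ-Δ⁅⁆ Gu X (V∖ u) (trans (∈-∁ ⁅ u ⁆ u) (cong not (a∈⁅a⁆ u))) ⟩
    nullityOn (Gu +ᴸ (X Δ ⁅ u ⁆)) (V∖ u)
      ∎

  nullity-v : ∀ X → u ∈ᵇ X ≡ false → v ∈ᵇ X ≡ true → nullityOn (G +ᴸ X) ⊤ ≡ nullityOn (Gvu +ᴸ (X Δ ⁅ v ⁆)) W
  nullity-v X u∉X v∈X = begin
    nullityOn (G +ᴸ X) ⊤
      ≡⟨ nullityOn-IsDualPivot {G = G} (IsDualPivot-⁅⁆ G v vv) X (∈ᵇ-on-⁅⁆ {a = v} {X} v∈X) ⊤ ⟩
    nullityOn (Gv +ᴸ X) (⊤ Δ ⁅ v ⁆)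
      ≡⟨ nullityOn-+ᴸ-IsPivot Gvu-pivot X (∈ᵇ-on-⁅⁆ {a = u} {X} u∉X) (⊤ Δ ⁅ v ⁆) ⟩
    nullityOn (Gvu +ᴸ X) ((⊤ Δ ⁅ v ⁆) Δ ⁅ u ⁆)
      ≡⟨ cong (nullityOn (Gvu +ᴸ X)) ⊤Δ⁅v⁆Δ⁅u⁆≡W ⟩
    nullityOn (Gvu +ᴸ X) W
      ≡⟨ nullityOn-+ᴸ-Δ⁅⁆ Gvu X W (trans (∈-∁ X₂ v) (cong not v∈X₂)) ⟩
    nullityOn (Gvu +ᴸ (X Δ ⁅ v ⁆)) W
      ∎

  module _ (k : ℕ) where

    nullity : Mat n → Subset n → Subset n → Bool
    nullity A L X = ℕeq (nullityOn (A +ᴸ X) L) k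

    rearrange : ∀ a b c → b ∧ (a ∧ c) ≡ (a ∧ b) ∧ c
    rearrange = solve 3 (λ a b c → b :* (a :* c) := (a :* b) :* c) refl

    class-uv : # (λ X → not (v ∈ᵇ X) ∧ (not (u ∈ᵇ X) ∧ nullity G ⊤ X)) ≡ q₂ Guv W k
    class-uv = trans (#-cong pointwise) (sym (count-subsetsOf-V∖₂ u v (nullity Guv W)))
      where
      pointwise : ∀ X → not (v ∈ᵇ X) ∧ (not (u ∈ᵇ X) ∧ nullity G ⊤ X) ≡
                        (not (u ∈ᵇ X) ∧ not (v ∈ᵇ X)) ∧ nullity Guv W X
      pointwise X = trans
        (not∧-cong-when (v ∈ᵇ X) (λ v∉X → not∧-cong-when (u ∈ᵇ X) (λ u∉X →
           cong (λ m → ℕeq m k) (nullity-uv X u∉X v∉X))))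
        (rearrange (not (u ∈ᵇ X)) (not (v ∈ᵇ X)) (nullity Guv W X))

    class-v : # (λ X → v ∈ᵇ X ∧ (not (u ∈ᵇ X) ∧ nullity G ⊤ X)) ≡ q₂ Gvu W k
    class-v = trans (#-reindex ⁅ v ⁆ pointwise) (sym (count-subsetsOf-V∖₂ u v (nullity Gvu W)))
      where
      pointwise : ∀ X → v ∈ᵇ X ∧ (not (u ∈ᵇ X) ∧ nullity G ⊤ X) ≡
                        (not (u ∈ᵇ (X Δ ⁅ v ⁆)) ∧ not (v ∈ᵇ (X Δ ⁅ v ⁆))) ∧ nullity Gvu W (X Δ ⁅ v ⁆)
      pointwise X = begin
        v ∈ᵇ X ∧ (not (u ∈ᵇ X) ∧ nullity G ⊤ X)
          ≡⟨ ∧-cong-when (v ∈ᵇ X) (λ v∈X → not∧-cong-when (u ∈ᵇ X) (λ u∉X →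
               cong (λ m → ℕeq m k) (nullity-v X u∉X v∈X))) ⟩
        v ∈ᵇ X ∧ (not (u ∈ᵇ X) ∧ nullity Gvu W (X Δ ⁅ v ⁆))
          ≡⟨ rearrange (not (u ∈ᵇ X)) (v ∈ᵇ X) (nullity Gvu W (X Δ ⁅ v ⁆)) ⟩
        (not (u ∈ᵇ X) ∧ v ∈ᵇ X) ∧ nullity Gvu W (X Δ ⁅ v ⁆)
          ≡⟨ cong₂ (λ a b → (not a ∧ b) ∧ nullity Gvu W (X Δ ⁅ v ⁆))
                   (sym (∈-Δ-∉ X (trans (∈-⁅⁆ v u) δvu))) (sym (not-∈-Δ-∈ X (a∈⁅a⁆ v))) ⟩
        (not (u ∈ᵇ (X Δ ⁅ v ⁆)) ∧ not (v ∈ᵇ (X Δ ⁅ v ⁆))) ∧ nullity Gvu W (X Δ ⁅ v ⁆)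
          ∎

    class-u : # (λ X → u ∈ᵇ X ∧ nullity G ⊤ X) ≡ q₂ Gu (V∖ u) k
    class-u = trans (#-reindex ⁅ u ⁆ pointwise) (sym (count-subsetsOf-V∖ u (nullity Gu (V∖ u))))
      where
      pointwise : ∀ X → u ∈ᵇ X ∧ nullity G ⊤ X ≡ not (u ∈ᵇ (X Δ ⁅ u ⁆)) ∧ nullity Gu (V∖ u) (X Δ ⁅ u ⁆)
      pointwise X = trans (∧-cong-when (u ∈ᵇ X) (λ u∈X → cong (λ m → ℕeq m k) (nullity-u X u∈X)))
                          (cong (_∧ nullity Gu (V∖ u) (X Δ ⁅ u ⁆)) (sym (not-∈-Δ-∈ X (a∈⁅a⁆ u))))

    q₂-classes : q₂ G ⊤ k ≡ (q₂ Guv W k + q₂ Gvu W k) + q₂ Gu (V∖ u) k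
    q₂-classes = begin
      q₂ G ⊤ k
        ≡⟨ count-subsetsOf-⊤ (nullity G ⊤) ⟩
      # (nullity G ⊤)
        ≡⟨ #-split (u ∈ᵇ_) (nullity G ⊤) ⟩
      # (λ X → not (u ∈ᵇ X) ∧ nullity G ⊤ X) + # (λ X → u ∈ᵇ X ∧ nullity G ⊤ X)
        ≡⟨ cong (_+ # (λ X → u ∈ᵇ X ∧ nullity G ⊤ X)) (#-split (v ∈ᵇ_) (λ X → not (u ∈ᵇ X) ∧ nullity G ⊤ X)) ⟩
      (# (λ X → not (v ∈ᵇ X) ∧ (not (u ∈ᵇ X) ∧ nullity G ⊤ X))
        + # (λ X → v ∈ᵇ X ∧ (not (u ∈ᵇ X) ∧ nullity G ⊤ X)))
        + # (λ X → u ∈ᵇ X ∧ nullity G ⊤ X)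
        ≡⟨ cong₂ _+_ (cong₂ _+_ class-uv class-v) class-u ⟩
      (q₂ Guv W k + q₂ Gvu W k) + q₂ Gu (V∖ u) k
        ∎

  ∉X₂ : ∀ {i} → δ u i ≡ false → δ v i ≡ false → i ∈ᵇ X₂ ≡ false
  ∉X₂ {i} ui vi = trans (∈-⁅⁆∪⁅⁆ u v i) (cong₂ _∨_ ui vi)

  G²-row-u : ∀ j → (G ⊗⟨ X₂ ⟩ G) u j ≡ G v j
  G²-row-u j rewrite sumOver-pair δuv (λ k → G u k ∧ G k j) | uu | uv = refl

  G²-row-v : ∀ j → (G ⊗⟨ X₂ ⟩ G) v j ≡ G u j
  G²-row-v j rewrite sumOver-pair δuv (λ k → G v k ∧ G k j) | vu | vv = xor-identityʳ (G u j)

  Guv-entry : ∀ {i j} → δ u i ≡ false → δ v i ≡ false → δ u j ≡ false → δ v j ≡ false →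
              Guv i j ≡ G i j xor ((G i u ∧ G v j) xor (G i v ∧ G u j))
  Guv-entry {i} {j} ui vi uj vj = begin
    Guv i j
      ≡⟨ pptEntry-out-out G X₂ G (∉X₂ ui vi) (∉X₂ uj vj) ⟩
    G i j xor (G ⊗⟨ X₂ ⟩ (G ⊗⟨ X₂ ⟩ G)) i j
      ≡⟨ cong (G i j xor_) (sumOver-pair δuv (λ k → G i k ∧ (G ⊗⟨ X₂ ⟩ G) k j)) ⟩
    G i j xor ((G i u ∧ (G ⊗⟨ X₂ ⟩ G) u j) xor (G i v ∧ (G ⊗⟨ X₂ ⟩ G) v j))
      ≡⟨ cong₂ (λ x y → G i j xor ((G i u ∧ x) xor (G i v ∧ y))) (G²-row-u j) (G²-row-v j) ⟩
    G i j xor ((G i u ∧ G v j) xor (G i v ∧ G u j))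
      ∎

  Guv-column : ∀ {i} → δ u i ≡ false → δ v i ≡ false → Guv i v ≡ G i u
  Guv-column {i} ui vi = begin
    Guv i v                                ≡⟨ pptEntry-out-in G X₂ G (∉X₂ ui vi) v∈X₂ ⟩
    (G ⊗⟨ X₂ ⟩ G) i v                      ≡⟨ sumOver-pair δuv (λ k → G i k ∧ G k v) ⟩
    (G i u ∧ G u v) xor (G i v ∧ G v v)    ≡⟨ cong₂ (λ x y → (G i u ∧ x) xor (G i v ∧ y)) uv vv ⟩
    (G i u ∧ true) xor (G i v ∧ false)     ≡⟨ cong₂ _xor_ (∧-identityʳ (G i u)) (∧-zeroʳ (G i v)) ⟩
    G i u xor false                        ≡⟨ xor-identityʳ (G i u) ⟩
    G i u                                  ∎

  Guv-row : ∀ {j} → δ u j ≡ false → δ v j ≡ false → Guv v j ≡ G u j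
  Guv-row {j} uj vj = trans (pptEntry-in-out G X₂ G v∈X₂ (∉X₂ uj vj)) (G²-row-v j)

  Guvv≐Gvu : Guvv ≐⟨ W ⟩ Gvu
  Guvv≐Gvu i j i∈W j∈W with ∈V∖₂⇒≢ {u = u} {v} i∈W | ∈V∖₂⇒≢ {u = u} {v} j∈W
  ... | ui , vi | uj , vj = begin
    Guvv i j
      ≡⟨ dualPivot⁅⁆-entry Guv v vi vj ⟩
    Guv i j xor (Guv i v ∧ Guv v j)
      ≡⟨ cong₂ (λ x y → x xor y) (Guv-entry ui vi uj vj) (cong₂ _∧_ (Guv-column ui vi) (Guv-row uj vj)) ⟩
    (G i j xor ((G i u ∧ G v j) xor (G i v ∧ G u j))) xor (G i u ∧ G u j)
      ≡⟨ solve 5 (λ a b c d e → (a :+ (b :* e :+ c :* d)) :+ b :* d := (a :+ c :* e) :+ (b :+ c) :* (d :+ e))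
                 refl (G i j) (G i u) (G i v) (G u j) (G v j) ⟩
    (G i j xor (G i v ∧ G v j)) xor ((G i u xor G i v) ∧ (G u j xor G v j))
      ≡⟨ sym (cong₂ (λ x y → x xor y) (dualPivot⁅⁆-entry G v vi vj) (cong₂ _∧_ Gv-column Gv-row)) ⟩
    Gv i j xor (Gv i u ∧ Gv u j)
      ≡⟨ sym (pptEntry-⁅⁆ Gv u ui uj) ⟩
    Gvu i j
      ∎
    where
    Gv-column : Gv i u ≡ G i u xor G i v
    Gv-column rewrite dualPivot⁅⁆-entry G v vi δvu | vu = cong (G i u xor_) (∧-identityʳ (G i v))
    Gv-row : Gv u j ≡ G u j xor G v j
    Gv-row rewrite dualPivot⁅⁆-entry G v δvu vj | uv = refl

  q₂-Guvv≡q₂-Gvu : ∀ k → q₂ Guvv W k ≡ q₂ Gvu W k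
  q₂-Guvv≡q₂-Gvu k = begin
    q₂ Guvv W k
      ≡⟨ count-subsetsOf W (λ X → ℕeq (nullityOn (Guvv +ᴸ X) W) k) ⟩
    # (λ X → X ⊆ᵇ W ∧ ℕeq (nullityOn (Guvv +ᴸ X) W) k)
      ≡⟨ #-cong (λ X → cong (λ m → X ⊆ᵇ W ∧ ℕeq m k) (nullityOn-cong W (λ i j i∈W j∈W →
           cong (_xor (δ i j ∧ i ∈ᵇ X)) (Guvv≐Gvu i j i∈W j∈W)))) ⟩
    # (λ X → X ⊆ᵇ W ∧ ℕeq (nullityOn (Gvu +ᴸ X) W) k)
      ≡⟨ sym (count-subsetsOf W (λ X → ℕeq (nullityOn (Gvu +ᴸ X) W) k)) ⟩
    q₂ Gvu W k
      ∎

q₂-recurrence : (G : Mat n) → Symmetric G → ∀ (u v : Fin n) → G u v ≡ true → G u u ≡ false → G v v ≡ false →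
  Σ (Mat n) λ Guv → IsPivot G (⁅ u ⁆ ∪ ⁅ v ⁆) Guv ×
  Σ (Mat n) λ Gv → IsDualPivot G ⁅ v ⁆ Gv ×
  Σ (Mat n) λ Gvu → IsPivot Gv ⁅ u ⁆ Gvu ×
  Σ (Mat n) λ Gu → IsDualPivot G ⁅ u ⁆ Gu ×
  Σ (Mat n) λ Guvv → IsDualPivot Guv ⁅ v ⁆ Guvv ×
    (∀ k → q₂ G ⊤ k ≡ ((q₂ Guv (V∖₂ u v) ⊕ q₂ Gvu (V∖₂ u v)) ⊕ q₂ Gu (V∖ u)) k)
  × (∀ k → q₂ G ⊤ k ≡ ((q₂ Guv (V∖₂ u v) ⊕ q₂ Guvv (V∖₂ u v)) ⊕ q₂ Gu (V∖ u)) k)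
q₂-recurrence G symmetric u v uv uu vv =
  Guv , Guv-pivot , Gv , IsDualPivot-⁅⁆ G v vv , Gvu , Gvu-pivot , Gu , IsDualPivot-⁅⁆ G u uu ,
  Guvv , IsDualPivot-⁅⁆ Guv v Guv-vv , q₂-classes ,
  λ k → trans (q₂-classes k) (cong (λ m → (q₂ Guv W k + m) + q₂ Gu (V∖ u) k) (sym (q₂-Guvv≡q₂-Gvu k)))
  where open LoopFreeEdge G symmetric uv uu vv

theorem34 : ∀ (n : ℕ) (G : Mat n) → Symmetric G →
    (∀ (u : Fin n) (X : Subset n) (GX : Mat n) → u ∈ᵇ X ≡ true → IsPivot G X GX →
      ∀ k → q₁ G ⊤ k ≡ (q₁ G (V∖ u) ⊕ q₁ GX (V∖ u)) k)
  × (∀ (u v : Fin n) → G u v ≡ true → G u u ≡ false → G v v ≡ false →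
      Σ (Mat n) λ Guv → IsPivot G (⁅ u ⁆ ∪ ⁅ v ⁆) Guv ×
      Σ (Mat n) λ Gv → IsDualPivot G ⁅ v ⁆ Gv ×
      Σ (Mat n) λ Gvu → IsPivot Gv ⁅ u ⁆ Gvu ×
      Σ (Mat n) λ Gu → IsDualPivot G ⁅ u ⁆ Gu ×
      Σ (Mat n) λ Guvv → IsDualPivot Guv ⁅ v ⁆ Guvv ×
        (∀ k → q₂ G ⊤ k ≡ ((q₂ Guv (V∖₂ u v) ⊕ q₂ Gvu (V∖₂ u v)) ⊕ q₂ Gu (V∖ u)) k)
      × (∀ k → q₂ G ⊤ k ≡ ((q₂ Guv (V∖₂ u v) ⊕ q₂ Guvv (V∖₂ u v)) ⊕ q₂ Gu (V∖ u)) k))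
  × (∀ (u : Fin n) (Y : Subset n) (GY : Mat n) → u ∈ᵇ Y ≡ true → IsDualPivot G Y GY →
      ∀ k → q₃ G ⊤ k ≡ (q₃ G (V∖ u) ⊕ q₃ GY (V∖ u)) k)
theorem34 n G symmetric = q₁-recurrence G , q₂-recurrence G symmetric , q₃-recurrence G
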